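{- Let $p$ be a prime, $m$ a positive integer, and $K=\mathbb{F}_{p^k}$ a finite field containing all $m$th roots of unity (i.e. $m\mid p^k-1$); let $d=(p^k-1)/m$. If $m_0:=\gcd(p-1,m)\geq 3$, then every integer $n\geq d+1$ lies in $W_p(m_0)$, and $W_p(m_0)\subseteq W_p(m)$.
   Context: For a prime $p$ and a positive integer $m$, $W_p(m)$ denotes the set of integers $n\geq 0$ for which there exist $\alpha_1,\dots,\alpha_n\in\overline{\mathbb{F}}_p$ with $\alpha_i^m=1$ for all $i$ (repetitions allowed) and $\alpha_1+\cdots+\alpha_n=0$. -}

module Defs where

open import Level using (Level; _⊔_) renaming (suc to lsuc)
open import Algebra.Bundles using (CommutativeRing)
open import Data.Nat using (ℕ; zero; suc)
open import Data.Fin using (Fin)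
open import Data.List using (List; []; _∷_)
open import Data.Product using (∃; _×_)
open import Relation.Nullary using (¬_)

module RingOps {c ℓ : Level} (R : CommutativeRing c ℓ) where
  open CommutativeRing R

  pow : Carrier → ℕ → Carrier
  pow x zero    = 1#
  pow x (suc n) = x * pow x n

  natCast : ℕ → Carrier
  natCast zero    = 0#
  natCast (suc n) = 1# + natCast n

  sumFin : (n : ℕ) → (Fin n → Carrier) → Carrier
  sumFin zero    α = 0#
  sumFin (suc n) α = α Fin.zero + sumFin n (λ i → α (Fin.suc i))

  -- value at x of the monic polynomial  x^len + c_{len-1} x^{len-1} + ... + c_0
  -- where the coefficient list is  c_0 ∷ c_1 ∷ ... ∷ c_{len-1}
  evalMonic : List Carrier → Carrier → Carrier
  evalMonic []       x = 1#
  evalMonic (a ∷ as) x = a + x * evalMonic as x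

-- An algebraically closed field of characteristic p (p is assumed prime where used).
record AlgClosedField (p : ℕ) (c ℓ : Level) : Set (lsuc (c ⊔ ℓ)) where
  field
    cring : CommutativeRing c ℓ
  open CommutativeRing cring public
  open RingOps cring public
  field
    nontrivial : ¬ (1# ≈ 0#)
    inverse    : ∀ x → ¬ (x ≈ 0#) → ∃ λ y → x * y ≈ 1#
    charP      : natCast p ≈ 0#
    algClosed  : ∀ (a : Carrier) (as : List Carrier) → ∃ λ x → evalMonic (a ∷ as) x ≈ 0#

-- W_p(m), computed inside an algebraically closed field Ω of characteristic p:
-- n ∈ W Ω m  iff there are α_1..α_n in Ω with α_i^m = 1 and Σ α_i = 0.
W : ∀ {p c ℓ} → AlgClosedField p c ℓ → ℕ → ℕ → Set (c ⊔ ℓ)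
W Ω m n = ∃ λ (α : Fin n → Carrier) → (∀ i → pow (α i) m ≈ 1#) × (sumFin n α ≈ 0#)
  where open AlgClosedField Ω

-- Since m₀ = gcd (p - 1, m) divides p - 1, the m₀-th roots of unity μ already lie in 𝔽ₚ, and there
-- are at least m₀ of them: every unit y has y^(p-1) = 1, and the cofactor of y^m₀ - 1 in y^(p-1) - 1
-- has too few roots to account for the rest.  Let Sⱼ be the set of sums of j elements of μ.  The set
-- Sⱼ ∖ {0} is stable under multiplication by μ, hence a union of cosets, so its size is a multiple of
-- |μ| ≥ 3; Cauchy–Davenport gives |Sⱼ₊₁| ≥ min (p, |Sⱼ| + |μ| - 1), and together these force
-- |Sⱼ ∖ {0}| ≥ min (j |μ|, p - 1).  Hence -1 ∈ Sⱼ once j m₀ ≥ p - 1, and adding 1 gives j + 1 roots of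
-- unity with sum 0, which the prime subfield carries into Ω.  Every n ≥ d + 1 is such a j + 1 because
-- lcm (p - 1, m) divides p^k - 1 = d m, i.e. d m₀ ≥ p - 1.  Finally m₀ ∣ m, so m₀-th roots of unity
-- are m-th roots of unity.

module Submission where

open import Level using (Level)
open import Algebra.Bundles using (Semiring; CommutativeRing)
open import Algebra.Morphism.Structures using (module SemiringMorphisms)
open import Data.Bool using (Bool; true; false; T; _∧_; _∨_; not; if_then_else_)
open import Data.Empty using (⊥-elim)
open import Data.Fin as Fin using (Fin; toℕ)
import Data.Fin.Properties as Finₚ
open import Data.Fin.Permutation using (Permutation; permutation; _⟨$⟩ʳ_)
open import Data.List using (List; []; _∷_; length; replicate; _++_)
open import Data.List.Properties using (length-++; length-replicate)
open import Data.Nat as ℕ using (ℕ; zero; suc; NonZero; _≤_; _<_; _∸_; z≤n; s≤s)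
import Data.Nat.Properties as ℕₚ
open import Data.Nat.Coprimality using (Coprime; coprime-Bézout)
open import Data.Nat.DivMod
  using (_mod_; m%n<n; %-distribˡ-+; %-distribˡ-*; n%n≡0; m<n⇒m%n≡m; m/n*n≡m; m≡m%n+[m/n]*n)
open import Data.Nat.Divisibility
  using (_∣_; divides; _∣0; ∣-refl; ∣m∣n⇒∣m+n; m∣m*n; ∣⇒≤; m%n≡0⇒n∣m; n∣m⇒m%n≡0)
open import Data.Nat.GCD using (gcd; gcd[m,n]∣m; gcd[m,n]∣n; module Bézout)
open import Data.Nat.LCM using (lcm; lcm-least; gcd*lcm)
open import Data.Nat.Primality using (Prime; prime⇒nonZero; prime⇒nonTrivial; prime⇒irreducible; euclidsLemma)
open import Data.Product using (∃; _×_; _,_; proj₁; proj₂)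
open import Data.Sum using (_⊎_; inj₁; inj₂)
open import Function using (_∘_)
open import Function.Bundles using (Equivalence)
import Relation.Binary.PropositionalEquality as ≡
open ≡ using (_≡_; _≢_)
open import Relation.Nullary using (¬_; ¬?; Dec; yes; no; does)
open import Relation.Nullary.Decidable using (T?; map′; dec-true; decidable-stable; _×-dec_)
open import Relation.Unary using (Pred; Decidable)

open import Defs

∣-next-multiple : ∀ {s a b} → s ∣ a → s ∣ b → a < b → a ℕ.+ s ≤ b
∣-next-multiple {s} (divides u ≡.refl) (divides v ≡.refl) us<vs = begin
  u ℕ.* s ℕ.+ s     ≡⟨ ℕₚ.+-comm (u ℕ.* s) s ⟩
  suc u ℕ.* s       ≤⟨ ℕₚ.*-monoˡ-≤ s (ℕₚ.*-cancelʳ-< s u v us<vs) ⟩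
  v ℕ.* s           ∎
  where open ℕₚ.≤-Reasoning

m∣[1+m]^k∸1 : ∀ m k → m ∣ suc m ℕ.^ k ∸ 1
m∣[1+m]^k∸1 m zero    = m ∣0
m∣[1+m]^k∸1 m (suc k) = ≡.subst (m ∣_) [x∸1]+mx≡[x+mx]∸1 (∣m∣n⇒∣m+n (m∣[1+m]^k∸1 m k) (m∣m*n x))
  where
  x = suc m ℕ.^ k
  [x∸1]+mx≡[x+mx]∸1 : (x ∸ 1) ℕ.+ m ℕ.* x ≡ (x ℕ.+ m ℕ.* x) ∸ 1
  [x∸1]+mx≡[x+mx]∸1 = ≡.sym (ℕₚ.+-∸-comm (m ℕ.* x) (ℕₚ.m^n>0 (suc m) k))

-- lcm (p - 1, m) divides p^k - 1, and (p - 1) m = gcd (p - 1, m) · lcm (p - 1, m).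
p∸1≤[p^k∸1]/m*gcd[p∸1,m] : ∀ {p k} m .{{_ : NonZero m}} → 1 < p → 0 < k → m ∣ p ℕ.^ k ∸ 1 →
                            p ∸ 1 ≤ (p ℕ.^ k ∸ 1) ℕ./ m ℕ.* gcd (p ∸ 1) m
p∸1≤[p^k∸1]/m*gcd[p∸1,m] {suc q} {k} m (s≤s 0<q) 0<k m∣Q = ℕₚ.*-cancelʳ-≤ q (d ℕ.* g) m (begin
  q ℕ.* m                 ≡⟨ gcd*lcm q m ⟨
  g ℕ.* lcm q m           ≤⟨ ℕₚ.*-monoʳ-≤ g (∣⇒≤ {{ℕ.>-nonZero 0<Q}} (lcm-least (m∣[1+m]^k∸1 q k) m∣Q)) ⟩
  g ℕ.* Q                 ≡⟨ ≡.cong (g ℕ.*_) (m/n*n≡m m∣Q) ⟨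
  g ℕ.* (d ℕ.* m)         ≡⟨ ℕₚ.*-assoc g d m ⟨
  g ℕ.* d ℕ.* m           ≡⟨ ≡.cong (ℕ._* m) (ℕₚ.*-comm g d) ⟩
  d ℕ.* g ℕ.* m           ∎)
  where
  open ℕₚ.≤-Reasoning
  Q = suc q ℕ.^ k ∸ 1
  d = Q ℕ./ m
  g = gcd q m
  0<Q : 0 < Q
  0<Q = ℕₚ.m<n⇒0<n∸m (ℕₚ.<-≤-trans (s≤s 0<q)
          (ℕₚ.≤-trans (ℕₚ.≤-reflexive (≡.sym (ℕₚ.*-identityʳ (suc q)))) (ℕₚ.^-monoʳ-≤ (suc q) 0<k)))

module RingOpsProperties {c ℓ : Level} (R : CommutativeRing c ℓ) where
  open CommutativeRing R
  open RingOps R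
  open import Algebra.Properties.Semiring.Exp semiring using (_^_; ^-congˡ; ^-assocʳ)
  open import Algebra.Properties.CommutativeSemiring.Exp commutativeSemiring using (^-distrib-*)
  import Algebra.Properties.Monoid.Mult +-monoid as Mult
  open import Algebra.Properties.Semiring.Mult semiring using (×1-homo-*)
  open import Relation.Binary.Reasoning.Setoid setoid

  pow≈^ : ∀ x n → pow x n ≈ x ^ n
  pow≈^ x zero    = refl
  pow≈^ x (suc n) = *-congˡ (pow≈^ x n)

  pow-cong : ∀ n {x y} → x ≈ y → pow x n ≈ pow y n
  pow-cong n {x} {y} x≈y = begin
    pow x n ≈⟨ pow≈^ x n ⟩
    x ^ n   ≈⟨ ^-congˡ n x≈y ⟩
    y ^ n   ≈⟨ pow≈^ y n ⟨
    pow y n ∎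

  pow-assoc : ∀ x m n → pow (pow x m) n ≈ pow x (m ℕ.* n)
  pow-assoc x m n = begin
    pow (pow x m) n ≈⟨ pow≈^ (pow x m) n ⟩
    pow x m ^ n     ≈⟨ ^-congˡ n (pow≈^ x m) ⟩
    (x ^ m) ^ n     ≈⟨ ^-assocʳ x m n ⟩
    x ^ (m ℕ.* n)   ≈⟨ pow≈^ x (m ℕ.* n) ⟨
    pow x (m ℕ.* n) ∎

  pow-distrib-* : ∀ x y n → pow (x * y) n ≈ pow x n * pow y n
  pow-distrib-* x y n = begin
    pow (x * y) n     ≈⟨ pow≈^ (x * y) n ⟩
    (x * y) ^ n       ≈⟨ ^-distrib-* x y n ⟩
    x ^ n * y ^ n     ≈⟨ *-cong (pow≈^ x n) (pow≈^ y n) ⟨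
    pow x n * pow y n ∎

  pow-1# : ∀ n → pow 1# n ≈ 1#
  pow-1# zero    = refl
  pow-1# (suc n) = trans (*-identityˡ (pow 1# n)) (pow-1# n)

  pow-0# : ∀ n .{{_ : NonZero n}} → pow 0# n ≈ 0#
  pow-0# (suc n) = zeroˡ (pow 0# n)

  natCast≈×1# : ∀ n → natCast n ≈ n Mult.× 1#
  natCast≈×1# zero    = refl
  natCast≈×1# (suc n) = +-congˡ (natCast≈×1# n)

  natCast-homo-+ : ∀ m n → natCast (m ℕ.+ n) ≈ natCast m + natCast n
  natCast-homo-+ m n = begin
    natCast (m ℕ.+ n)       ≈⟨ natCast≈×1# (m ℕ.+ n) ⟩
    (m ℕ.+ n) Mult.× 1#          ≈⟨ Mult.×-homo-+ 1# m n ⟩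
    m Mult.× 1# + n Mult.× 1#         ≈⟨ +-cong (natCast≈×1# m) (natCast≈×1# n) ⟨
    natCast m + natCast n   ∎

  natCast-homo-* : ∀ m n → natCast (m ℕ.* n) ≈ natCast m * natCast n
  natCast-homo-* m n = begin
    natCast (m ℕ.* n)       ≈⟨ natCast≈×1# (m ℕ.* n) ⟩
    (m ℕ.* n) Mult.× 1#          ≈⟨ ×1-homo-* m n ⟩
    m Mult.× 1# * n Mult.× 1#         ≈⟨ *-cong (natCast≈×1# m) (natCast≈×1# n) ⟨
    natCast m * natCast n   ∎

  open import Algebra.Solver.Ring.NaturalCoefficients.Default commutativeSemiring
    using (solve; _:+_; _:*_; _:=_; con)
  open import Algebra.Properties.Group +-group using (//-rightDividesˡ)

  evalMonic-divide : ∀ c cs r → ∃ λ q → length q ≡ length cs ×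
    (∀ x → evalMonic (c ∷ cs) x ≈ (x - r) * evalMonic q x + evalMonic (c ∷ cs) r)
  evalMonic-divide c [] r = [] , ≡.refl , λ x → begin
    c + x * 1#                   ≈⟨ +-congˡ (*-congʳ (x≈[x-r]+r x)) ⟩
    c + ((x - r) + r) * 1#       ≈⟨ solve 3 (λ c d r → c :+ (d :+ r) :* 1′ := d :* 1′ :+ (c :+ r :* 1′)) refl c (x - r) r ⟩
    (x - r) * 1# + (c + r * 1#)  ∎
    where
    1′ = con 1
    x≈[x-r]+r : ∀ x → x ≈ (x - r) + r
    x≈[x-r]+r x = sym (//-rightDividesˡ r x)
  evalMonic-divide c (c₁ ∷ cs) r with evalMonic-divide c₁ cs r
  ... | q , |q|≡|cs| , division = (v ∷ q) , ≡.cong suc |q|≡|cs| , λ x →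
    let d = x - r ; u = evalMonic q x ; x≈d+r = sym (//-rightDividesˡ r x) in begin
    c + x * evalMonic (c₁ ∷ cs) x         ≈⟨ +-congˡ (*-congˡ (division x)) ⟩
    c + x * (d * u + v)                   ≈⟨ +-congˡ (*-congʳ x≈d+r) ⟩
    c + (d + r) * (d * u + v)             ≈⟨ solve 5 (λ c d r u v → c :+ (d :+ r) :* (d :* u :+ v) := d :* (v :+ (d :+ r) :* u) :+ (c :+ r :* v)) refl c d r u v ⟩
    d * (v + (d + r) * u) + (c + r * v)   ≈⟨ +-congʳ (*-congˡ (+-congˡ (*-congʳ (sym x≈d+r)))) ⟩
    d * (v + x * u) + (c + r * v)         ∎
    where v = evalMonic (c₁ ∷ cs) r

  evalMonic-zeros : ∀ j cs x → evalMonic (replicate j 0# ++ cs) x ≈ pow x j * evalMonic cs x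
  evalMonic-zeros zero    cs x = sym (*-identityˡ (evalMonic cs x))
  evalMonic-zeros (suc j) cs x = begin
    0# + x * evalMonic (replicate j 0# ++ cs) x ≈⟨ +-identityˡ _ ⟩
    x * evalMonic (replicate j 0# ++ cs) x      ≈⟨ *-congˡ (evalMonic-zeros j cs x) ⟩
    x * (pow x j * evalMonic cs x)              ≈⟨ *-assoc x (pow x j) (evalMonic cs x) ⟨
    pow x (suc j) * evalMonic cs x              ∎

  -- geometric m k is the monic polynomial 1 + Y + ... + Y^k in Y = x^(m+1), of degree k(m+1).
  geometric : ℕ → ℕ → List Carrier
  geometric m zero    = []
  geometric m (suc k) = 1# ∷ replicate m 0# ++ geometric m k

  length-geometric : ∀ m k → length (geometric m k) ≡ k ℕ.* suc m
  length-geometric m zero    = ≡.refl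
  length-geometric m (suc k) = ≡.cong suc (≡.trans (length-++ (replicate m 0#))
    (≡.cong₂ ℕ._+_ (length-replicate m) (length-geometric m k)))

  -- The geometric series identity (Y - 1) G = Y^(k+1) - 1, written without subtraction.
  geometric-sum : ∀ m k x → let Y = pow x (suc m) ; G = evalMonic (geometric m k) x in
                  Y * G + 1# ≈ G + pow Y (suc k)
  geometric-sum m zero x = solve 1 (λ Y → Y :* con 1 :+ con 1 := con 1 :+ Y :* con 1) refl (pow x (suc m))
  geometric-sum m (suc k) x = begin
    Y * (1# + x * G′) + 1#          ≈⟨ +-congʳ (*-congˡ (+-congˡ x*G′≈YG)) ⟩
    Y * (1# + Y * G) + 1#           ≈⟨ solve 2 (λ Y G → Y :* (con 1 :+ Y :* G) :+ con 1 := Y :* (Y :* G :+ con 1) :+ con 1) refl Y G ⟩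
    Y * (Y * G + 1#) + 1#           ≈⟨ +-congʳ (*-congˡ (geometric-sum m k x)) ⟩
    Y * (G + pow Y (suc k)) + 1#    ≈⟨ solve 3 (λ Y G Z → Y :* (G :+ Z) :+ con 1 := (con 1 :+ Y :* G) :+ Y :* Z) refl Y G (pow Y (suc k)) ⟩
    (1# + Y * G) + pow Y (suc (suc k)) ≈⟨ +-congʳ (+-congˡ x*G′≈YG) ⟨
    (1# + x * G′) + pow Y (suc (suc k)) ∎
    where
    Y = pow x (suc m)
    G = evalMonic (geometric m k) x
    G′ = evalMonic (replicate m 0# ++ geometric m k) x
    x*G′≈YG : x * G′ ≈ Y * G
    x*G′≈YG = trans (*-congˡ (evalMonic-zeros m (geometric m k) x)) (sym (*-assoc x (pow x m) G))

module HomomorphismProperties {a b ℓa ℓb : Level}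
  (R : CommutativeRing a ℓa) (S : CommutativeRing b ℓb)
  (f : CommutativeRing.Carrier R → CommutativeRing.Carrier S)
  (isHom : SemiringMorphisms.IsSemiringHomomorphism
             (Semiring.rawSemiring (CommutativeRing.semiring R))
             (Semiring.rawSemiring (CommutativeRing.semiring S)) f)
  where
  module Rᴼ = RingOps R
  open CommutativeRing S
  open RingOps S
  open SemiringMorphisms.IsSemiringHomomorphism isHom

  homo-pow : ∀ x n → f (Rᴼ.pow x n) ≈ pow (f x) n
  homo-pow x zero    = 1#-homo
  homo-pow x (suc n) = trans (*-homo x (Rᴼ.pow x n)) (*-congˡ (homo-pow x n))

  homo-sumFin : ∀ n α → f (Rᴼ.sumFin n α) ≈ sumFin n (f ∘ α)
  homo-sumFin zero    α = 0#-homo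
  homo-sumFin (suc n) α =
    trans (+-homo (α Fin.zero) _) (+-congˡ (homo-sumFin n (α ∘ Fin.suc)))

module IntegersModulo (n : ℕ) .{{_ : NonZero n}} where
  open ≡ using (refl; sym; trans; cong; cong₂; module ≡-Reasoning)
  open ≡-Reasoning
  open import Algebra.Structures using (IsCommutativeRing)

  [_] : ℕ → Fin n
  [ x ] = x mod n

  toℕ-[] : ∀ x → toℕ [ x ] ≡ x ℕ.% n
  toℕ-[] x = Finₚ.toℕ-fromℕ< (m%n<n x n)

  []-≡ : ∀ {x y} → x ℕ.% n ≡ y ℕ.% n → [ x ] ≡ [ y ]
  []-≡ {x} {y} eq = Finₚ.toℕ-injective (trans (toℕ-[] x) (trans eq (sym (toℕ-[] y))))

  []-toℕ : ∀ a → [ toℕ a ] ≡ a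
  []-toℕ a = Finₚ.toℕ-injective (trans (toℕ-[] (toℕ a)) (m<n⇒m%n≡m (Finₚ.toℕ<n a)))

  infixl 6 _+_
  infixl 7 _*_
  infix 8 -_

  _+_ : Fin n → Fin n → Fin n
  a + b = [ toℕ a ℕ.+ toℕ b ]

  _*_ : Fin n → Fin n → Fin n
  a * b = [ toℕ a ℕ.* toℕ b ]

  -_ : Fin n → Fin n
  - a = [ n ∸ toℕ a ]

  0ₙ 1ₙ : Fin n
  0ₙ = [ 0 ]
  1ₙ = [ 1 ]

  []-homo-+ : ∀ x y → [ x ℕ.+ y ] ≡ [ x ] + [ y ]
  []-homo-+ x y = []-≡ (begin
    (x ℕ.+ y) ℕ.% n                          ≡⟨ %-distribˡ-+ x y n ⟩
    (x ℕ.% n ℕ.+ y ℕ.% n) ℕ.% n              ≡⟨ cong₂ (λ u v → (u ℕ.+ v) ℕ.% n) (toℕ-[] x) (toℕ-[] y) ⟨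
    (toℕ [ x ] ℕ.+ toℕ [ y ]) ℕ.% n          ∎)

  []-homo-* : ∀ x y → [ x ℕ.* y ] ≡ [ x ] * [ y ]
  []-homo-* x y = []-≡ (begin
    (x ℕ.* y) ℕ.% n                          ≡⟨ %-distribˡ-* x y n ⟩
    (x ℕ.% n ℕ.* (y ℕ.% n)) ℕ.% n            ≡⟨ cong₂ (λ u v → (u ℕ.* v) ℕ.% n) (toℕ-[] x) (toℕ-[] y) ⟨
    (toℕ [ x ] ℕ.* toℕ [ y ]) ℕ.% n          ∎)

  [n]≡0ₙ : [ n ] ≡ 0ₙ
  [n]≡0ₙ = []-≡ (trans (n%n≡0 n) (sym (m<n⇒m%n≡m (ℕ.>-nonZero⁻¹ n))))

  +-assoc : ∀ a b c → (a + b) + c ≡ a + (b + c)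
  +-assoc a b c = begin
    (a + b) + c                 ≡⟨ cong ((a + b) +_) ([]-toℕ c) ⟨
    [ A ℕ.+ B ] + [ C ]         ≡⟨ []-homo-+ (A ℕ.+ B) C ⟨
    [ A ℕ.+ B ℕ.+ C ]           ≡⟨ cong [_] (ℕₚ.+-assoc A B C) ⟩
    [ A ℕ.+ (B ℕ.+ C) ]         ≡⟨ []-homo-+ A (B ℕ.+ C) ⟩
    [ A ] + (b + c)             ≡⟨ cong (_+ (b + c)) ([]-toℕ a) ⟩
    a + (b + c)                 ∎
    where A = toℕ a ; B = toℕ b ; C = toℕ c

  *-assoc : ∀ a b c → (a * b) * c ≡ a * (b * c)
  *-assoc a b c = begin
    (a * b) * c                 ≡⟨ cong ((a * b) *_) ([]-toℕ c) ⟨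
    [ A ℕ.* B ] * [ C ]         ≡⟨ []-homo-* (A ℕ.* B) C ⟨
    [ A ℕ.* B ℕ.* C ]           ≡⟨ cong [_] (ℕₚ.*-assoc A B C) ⟩
    [ A ℕ.* (B ℕ.* C) ]         ≡⟨ []-homo-* A (B ℕ.* C) ⟩
    [ A ] * (b * c)             ≡⟨ cong (_* (b * c)) ([]-toℕ a) ⟩
    a * (b * c)                 ∎
    where A = toℕ a ; B = toℕ b ; C = toℕ c

  +-comm : ∀ a b → a + b ≡ b + a
  +-comm a b = cong [_] (ℕₚ.+-comm (toℕ a) (toℕ b))

  *-comm : ∀ a b → a * b ≡ b * a
  *-comm a b = cong [_] (ℕₚ.*-comm (toℕ a) (toℕ b))

  +-identityˡ : ∀ a → 0ₙ + a ≡ a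
  +-identityˡ a = begin
    0ₙ + a                      ≡⟨ cong (0ₙ +_) ([]-toℕ a) ⟨
    [ 0 ] + [ toℕ a ]           ≡⟨ []-homo-+ 0 (toℕ a) ⟨
    [ toℕ a ]                   ≡⟨ []-toℕ a ⟩
    a                           ∎

  *-identityˡ : ∀ a → 1ₙ * a ≡ a
  *-identityˡ a = begin
    1ₙ * a                      ≡⟨ cong (1ₙ *_) ([]-toℕ a) ⟨
    [ 1 ] * [ toℕ a ]           ≡⟨ []-homo-* 1 (toℕ a) ⟨
    [ 1 ℕ.* toℕ a ]             ≡⟨ cong [_] (ℕₚ.*-identityˡ (toℕ a)) ⟩
    [ toℕ a ]                   ≡⟨ []-toℕ a ⟩
    a                           ∎

  -‿inverseˡ : ∀ a → - a + a ≡ 0ₙ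
  -‿inverseˡ a = begin
    - a + a                     ≡⟨ cong (- a +_) ([]-toℕ a) ⟨
    [ n ∸ toℕ a ] + [ toℕ a ]   ≡⟨ []-homo-+ (n ∸ toℕ a) (toℕ a) ⟨
    [ n ∸ toℕ a ℕ.+ toℕ a ]     ≡⟨ cong [_] (ℕₚ.m∸n+n≡m (ℕₚ.<⇒≤ (Finₚ.toℕ<n a))) ⟩
    [ n ]                       ≡⟨ [n]≡0ₙ ⟩
    0ₙ                          ∎

  *-distribʳ-+ : ∀ a b c → (b + c) * a ≡ b * a + c * a
  *-distribʳ-+ a b c = begin
    (b + c) * a                 ≡⟨ cong ((b + c) *_) ([]-toℕ a) ⟨
    [ B ℕ.+ C ] * [ A ]         ≡⟨ []-homo-* (B ℕ.+ C) A ⟨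
    [ (B ℕ.+ C) ℕ.* A ]         ≡⟨ cong [_] (ℕₚ.*-distribʳ-+ A B C) ⟩
    [ B ℕ.* A ℕ.+ C ℕ.* A ]     ≡⟨ []-homo-+ (B ℕ.* A) (C ℕ.* A) ⟩
    b * a + c * a               ∎
    where A = toℕ a ; B = toℕ b ; C = toℕ c

  isCommutativeRing : IsCommutativeRing _≡_ _+_ _*_ -_ 0ₙ 1ₙ
  isCommutativeRing = record
    { isRing = record
      { +-isAbelianGroup = record
        { isGroup = record
          { isMonoid = record
            { isSemigroup = record
              { isMagma = record { isEquivalence = ≡.isEquivalence ; ∙-cong = cong₂ _+_ }
              ; assoc = +-assoc }
            ; identity = +-identityˡ , λ a → trans (+-comm a 0ₙ) (+-identityˡ a) }
          ; inverse = -‿inverseˡ , λ a → trans (+-comm a (- a)) (-‿inverseˡ a)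
          ; ⁻¹-cong = cong -_ }
        ; comm = +-comm }
      ; *-cong = cong₂ _*_
      ; *-assoc = *-assoc
      ; *-identity = *-identityˡ , λ a → trans (*-comm a 1ₙ) (*-identityˡ a)
      ; distrib = (λ a b c → trans (*-comm a (b + c))
                               (trans (*-distribʳ-+ a b c) (cong₂ _+_ (*-comm b a) (*-comm c a))))
                , *-distribʳ-+ }
    ; *-comm = *-comm }

  ℤ/nℤ : CommutativeRing _ _
  ℤ/nℤ = record { isCommutativeRing = isCommutativeRing }

-- Subsets are characteristic functions (rather than the vectors of Data.Fin.Subset) so that
-- sumsets and translates can be defined pointwise.
module FinSubsets where
  open ≡ using (refl; sym; trans; cong; cong₂; module ≡-Reasoning)
  open import Data.Bool.Properties using (T-∧; T-∨; T-≡; ∧-zeroʳ; ∧-identityʳ)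
  import Data.Sum as Sum
  import Data.Product as Product
  open import Algebra.Properties.CommutativeMonoid.Sum ℕₚ.+-0-commutativeMonoid
    using (sum; sum-cong-≗; ∑-distrib-+; sum-permute)

  Subset : ℕ → Set
  Subset n = Fin n → Bool

  infix 4 _∈_ _∉_ _⊆_ _∈?_
  infixr 7 _∩_
  infixr 6 _∪_ _─_

  -- A record rather than T (A x), so that x and A can be inferred from a membership proof.
  record _∈_ {n} (x : Fin n) (A : Subset n) : Set where
    constructor mk∈
    field ∈-true : T (A x)
  open _∈_ public

  _∉_ : ∀ {n} → Fin n → Subset n → Set
  x ∉ A = ¬ x ∈ A

  _⊆_ : ∀ {n} → Subset n → Subset n → Set
  A ⊆ B = ∀ {x} → x ∈ A → x ∈ B

  _∪_ _∩_ : ∀ {n} → Subset n → Subset n → Subset n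
  (A ∪ B) x = A x ∨ B x
  (A ∩ B) x = A x ∧ B x

  ∅ U : ∀ {n} → Subset n
  ∅ _ = false
  U _ = true

  ∁ : ∀ {n} → Subset n → Subset n
  ∁ A x = not (A x)

  _─_ : ∀ {n} → Subset n → Subset n → Subset n
  A ─ B = A ∩ ∁ B

  ⟦_⟧ : ∀ {n ℓ} {P : Pred (Fin n) ℓ} → Decidable P → Subset n
  ⟦ P? ⟧ x = does (P? x)

  ⁅_⁆ : ∀ {n} → Fin n → Subset n
  ⁅ a ⁆ = ⟦ Finₚ._≟ a ⟧

  module _ {n} {A : Subset n} {x : Fin n} where
    ≡true⇒∈ : A x ≡ true → x ∈ A
    ≡true⇒∈ eq = mk∈ (≡.subst T (sym eq) _)

    ≡false⇒∉ : A x ≡ false → x ∉ A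
    ≡false⇒∉ eq (mk∈ x∈A) = ≡.subst T eq x∈A

  _∈?_ : ∀ {n} (x : Fin n) (A : Subset n) → Dec (x ∈ A)
  x ∈? A = map′ mk∈ ∈-true (T? (A x))

  module _ {n ℓ} {P : Pred (Fin n) ℓ} (P? : Decidable P) {x : Fin n} where
    ∈-⟦⟧⁺ : P x → x ∈ ⟦ P? ⟧
    ∈-⟦⟧⁺ px = ≡true⇒∈ (dec-true (P? x) px)

    ∈-⟦⟧⁻ : x ∈ ⟦ P? ⟧ → P x
    ∈-⟦⟧⁻ (mk∈ x∈⟦P⟧) with P? x
    ... | yes px = px
    ... | no _   = ⊥-elim x∈⟦P⟧

  module _ {n} {A B : Subset n} {x : Fin n} where
    ∈-∪⁺ˡ : x ∈ A → x ∈ A ∪ B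
    ∈-∪⁺ˡ (mk∈ x∈A) = mk∈ (Equivalence.from T-∨ (inj₁ x∈A))

    ∈-∪⁺ʳ : x ∈ B → x ∈ A ∪ B
    ∈-∪⁺ʳ (mk∈ x∈B) = mk∈ (Equivalence.from T-∨ (inj₂ x∈B))

    ∈-∪⁻ : x ∈ A ∪ B → x ∈ A ⊎ x ∈ B
    ∈-∪⁻ (mk∈ x∈A∪B) = Sum.map mk∈ mk∈ (Equivalence.to T-∨ x∈A∪B)

    ∈-∩⁺ : x ∈ A → x ∈ B → x ∈ A ∩ B
    ∈-∩⁺ (mk∈ x∈A) (mk∈ x∈B) = mk∈ (Equivalence.from T-∧ (x∈A , x∈B))

    ∈-∩⁻ : x ∈ A ∩ B → x ∈ A × x ∈ B
    ∈-∩⁻ (mk∈ x∈A∩B) = Product.map mk∈ mk∈ (Equivalence.to T-∧ x∈A∩B)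

  module _ {n} {A : Subset n} {x : Fin n} where
    ∈-∁⁺ : x ∉ A → x ∈ ∁ A
    ∈-∁⁺ x∉A = mk∈ (not-intro (A x) (x∉A ∘ mk∈))
      where
      not-intro : ∀ b → ¬ T b → T (not b)
      not-intro true  ¬b = ¬b _
      not-intro false _  = _

    ∈-∁⁻ : x ∈ ∁ A → x ∉ A
    ∈-∁⁻ (mk∈ x∈∁A) (mk∈ x∈A) = not-elim (A x) x∈∁A x∈A
      where
      not-elim : ∀ b → T (not b) → ¬ T b
      not-elim true  () _
      not-elim false _  ()

  module _ {n} {A B : Subset n} {x : Fin n} where
    ∈-─⁺ : x ∈ A → x ∉ B → x ∈ A ─ B
    ∈-─⁺ x∈A x∉B = ∈-∩⁺ x∈A (∈-∁⁺ x∉B)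

    ∈-─⁻ : x ∈ A ─ B → x ∈ A × x ∉ B
    ∈-─⁻ x∈A─B = Product.map₂ ∈-∁⁻ (∈-∩⁻ x∈A─B)

  χ : Bool → ℕ
  χ true  = 1
  χ false = 0

  ∣_∣ : ∀ {n} → Subset n → ℕ
  ∣ A ∣ = sum (χ ∘ A)

  module _ {n : ℕ} where

    ∣∣-cong : {A B : Subset n} → (∀ x → A x ≡ B x) → ∣ A ∣ ≡ ∣ B ∣
    ∣∣-cong A≗B = sum-cong-≗ (cong χ ∘ A≗B)

    ∣∣-permute : (A : Subset n) (π : Permutation n n) → ∣ A ∘ (π ⟨$⟩ʳ_) ∣ ≡ ∣ A ∣
    ∣∣-permute A π = sym (sum-permute (χ ∘ A) π)

    ∣A∪B∣+∣A∩B∣≡∣A∣+∣B∣ : (A B : Subset n) → ∣ A ∪ B ∣ ℕ.+ ∣ A ∩ B ∣ ≡ ∣ A ∣ ℕ.+ ∣ B ∣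
    ∣A∪B∣+∣A∩B∣≡∣A∣+∣B∣ A B = begin
      ∣ A ∪ B ∣ ℕ.+ ∣ A ∩ B ∣               ≡⟨ ∑-distrib-+ (χ ∘ (A ∪ B)) (χ ∘ (A ∩ B)) ⟨
      sum (λ x → χ (A x ∨ B x) ℕ.+ χ (A x ∧ B x)) ≡⟨ sum-cong-≗ (λ x → pointwise (A x) (B x)) ⟩
      sum (λ x → χ (A x) ℕ.+ χ (B x))       ≡⟨ ∑-distrib-+ (χ ∘ A) (χ ∘ B) ⟩
      ∣ A ∣ ℕ.+ ∣ B ∣                       ∎
      where
      open ≡-Reasoning
      pointwise : ∀ a b → χ (a ∨ b) ℕ.+ χ (a ∧ b) ≡ χ a ℕ.+ χ b
      pointwise false false = refl
      pointwise false true  = refl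
      pointwise true  false = refl
      pointwise true  true  = refl

    ∣A∣≡∣A∩B∣+∣A─B∣ : (A B : Subset n) → ∣ A ∣ ≡ ∣ A ∩ B ∣ ℕ.+ ∣ A ─ B ∣
    ∣A∣≡∣A∩B∣+∣A─B∣ A B = begin
      ∣ A ∣                                 ≡⟨ sum-cong-≗ (λ x → pointwise (A x) (B x)) ⟩
      sum (λ x → χ (A x ∧ B x) ℕ.+ χ (A x ∧ not (B x))) ≡⟨ ∑-distrib-+ (χ ∘ (A ∩ B)) (χ ∘ (A ─ B)) ⟩
      ∣ A ∩ B ∣ ℕ.+ ∣ A ─ B ∣               ∎
      where
      open ≡-Reasoning
      pointwise : ∀ a b → χ a ≡ χ (a ∧ b) ℕ.+ χ (a ∧ not b)
      pointwise false b     = refl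
      pointwise true  false = refl
      pointwise true  true  = refl

    ∣A∪B∣≤∣A∣+∣B∣ : (A B : Subset n) → ∣ A ∪ B ∣ ≤ ∣ A ∣ ℕ.+ ∣ B ∣
    ∣A∪B∣≤∣A∣+∣B∣ A B =
      ℕₚ.≤-trans (ℕₚ.m≤m+n ∣ A ∪ B ∣ ∣ A ∩ B ∣) (ℕₚ.≤-reflexive (∣A∪B∣+∣A∩B∣≡∣A∣+∣B∣ A B))

  B⊆A⇒∣A∩B∣≡∣B∣ : ∀ {n} {A B : Subset n} → B ⊆ A → ∣ A ∩ B ∣ ≡ ∣ B ∣
  B⊆A⇒∣A∩B∣≡∣B∣ {A = A} {B} B⊆A = ∣∣-cong pointwise
    where
    pointwise : ∀ x → A x ∧ B x ≡ B x
    pointwise x with B x in x∈B?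
    ... | false = ∧-zeroʳ (A x)
    ... | true  = ≡.trans (∧-identityʳ (A x))
                          (Equivalence.to T-≡ (∈-true (B⊆A (≡true⇒∈ {A = B} x∈B?))))

  χ-mono : ∀ {a b} → (T a → T b) → χ a ≤ χ b
  χ-mono {false} {b}     _   = z≤n
  χ-mono {true}  {true}  _   = s≤s z≤n
  χ-mono {true}  {false} a⇒b = ⊥-elim (a⇒b _)

  A⊆B⇒∣A∣≤∣B∣ : ∀ {n} {A B : Subset n} → A ⊆ B → ∣ A ∣ ≤ ∣ B ∣
  A⊆B⇒∣A∣≤∣B∣ {zero}          A⊆B = z≤n
  A⊆B⇒∣A∣≤∣B∣ {suc n} {A} {B} A⊆B =
    ℕₚ.+-mono-≤ (χ-mono (∈-true ∘ A⊆B ∘ mk∈)) (A⊆B⇒∣A∣≤∣B∣ {A = A ∘ Fin.suc} {B ∘ Fin.suc} (mk∈ ∘ ∈-true ∘ A⊆B ∘ mk∈ ∘ ∈-true))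

  A⊂B⇒∣A∣<∣B∣ : ∀ {n} {A B : Subset n} {y} → A ⊆ B → y ∈ B → y ∉ A → ∣ A ∣ < ∣ B ∣
  A⊂B⇒∣A∣<∣B∣ {suc n} {A} {B} {Fin.zero} A⊆B (mk∈ y∈B) y∉A =
    head< (A Fin.zero) (B Fin.zero) y∈B (y∉A ∘ mk∈) (A⊆B⇒∣A∣≤∣B∣ {A = A ∘ Fin.suc} {B ∘ Fin.suc} (mk∈ ∘ ∈-true ∘ A⊆B ∘ mk∈ ∘ ∈-true))
    where
    head< : ∀ a b {k l} → T b → ¬ T a → k ≤ l → χ a ℕ.+ k < χ b ℕ.+ l
    head< false true _ _  k≤l = s≤s k≤l
    head< true  _    _ ¬a _   = ⊥-elim (¬a _)
  A⊂B⇒∣A∣<∣B∣ {suc n} {A} {B} {Fin.suc y} A⊆B (mk∈ y∈B) y∉A =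
    ℕₚ.+-mono-≤-< (χ-mono (∈-true ∘ A⊆B ∘ mk∈))
      (A⊂B⇒∣A∣<∣B∣ {A = A ∘ Fin.suc} {B ∘ Fin.suc} (mk∈ ∘ ∈-true ∘ A⊆B ∘ mk∈ ∘ ∈-true) (mk∈ y∈B) (y∉A ∘ mk∈ ∘ ∈-true))

  ∀∉⇒∣A∣≡0 : ∀ {n} (A : Subset n) → (∀ x → x ∉ A) → ∣ A ∣ ≡ 0
  ∀∉⇒∣A∣≡0 {zero}  _ _  = refl
  ∀∉⇒∣A∣≡0 {suc n} A ∉A with A Fin.zero in eq
  ... | true  = ⊥-elim (∉A Fin.zero (≡true⇒∈ {A = A} eq))
  ... | false = ∀∉⇒∣A∣≡0 (A ∘ Fin.suc) (λ x → ∉A (Fin.suc x) ∘ mk∈ ∘ ∈-true)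

  ∀∈⇒∣A∣≡n : ∀ {n} (A : Subset n) → (∀ x → x ∈ A) → ∣ A ∣ ≡ n
  ∀∈⇒∣A∣≡n {zero}  _ _  = refl
  ∀∈⇒∣A∣≡n {suc n} A ∈A with A Fin.zero in eq
  ... | true  = cong suc (∀∈⇒∣A∣≡n (A ∘ Fin.suc) (λ x → mk∈ (∈-true (∈A (Fin.suc x)))))
  ... | false = ⊥-elim (≡false⇒∉ {A = A} eq (∈A Fin.zero))

  ∣⁅x⁆∣≡1 : ∀ {n} (x : Fin n) → ∣ ⁅ x ⁆ ∣ ≡ 1
  ∣⁅x⁆∣≡1 {suc n} Fin.zero    = cong suc (∀∉⇒∣A∣≡0 (∅ {n}) (λ _ → λ ()))
  ∣⁅x⁆∣≡1 {suc n} (Fin.suc x) = ∣⁅x⁆∣≡1 x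

  ∣A∣+∣∁A∣≡n : ∀ {n} (A : Subset n) → ∣ A ∣ ℕ.+ ∣ ∁ A ∣ ≡ n
  ∣A∣+∣∁A∣≡n {n} A = begin
    ∣ A ∣ ℕ.+ ∣ ∁ A ∣                ≡⟨ ∑-distrib-+ (χ ∘ A) (χ ∘ ∁ A) ⟨
    sum (λ x → χ (A x) ℕ.+ χ (not (A x))) ≡⟨ sum-cong-≗ (λ x → pointwise (A x)) ⟩
    ∣ U {n} ∣                        ≡⟨ ∀∈⇒∣A∣≡n (U {n}) _ ⟩
    n                                ∎
    where
    open ≡-Reasoning
    pointwise : ∀ a → χ a ℕ.+ χ (not a) ≡ 1
    pointwise false = refl
    pointwise true  = refl

  x∈A⇒0<∣A∣ : ∀ {n} {A : Subset n} {x} → x ∈ A → 0 < ∣ A ∣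
  x∈A⇒0<∣A∣ {n} {A} x∈A = ≡.subst (_< ∣ A ∣) (∀∉⇒∣A∣≡0 (∅ {n}) (λ _ → λ ()))
    (A⊂B⇒∣A∣<∣B∣ {A = ∅} {A} (λ ()) x∈A (λ ()))

  0<∣A∣⇒∃∈ : ∀ {n} {A : Subset n} → 0 < ∣ A ∣ → ∃ (_∈ A)
  0<∣A∣⇒∃∈ {A = A} 0<∣A∣ with Finₚ.any? (_∈? A)
  ... | yes ∃x∈A = ∃x∈A
  ... | no  ∄x∈A = ⊥-elim (ℕₚ.<-irrefl (sym (∀∉⇒∣A∣≡0 A (λ x x∈A → ∄x∈A (x , x∈A)))) 0<∣A∣)

  1<∣A∣⇒∃≢ : ∀ {n} {A : Subset n} {x} → x ∈ A → 1 < ∣ A ∣ → ∃ λ y → y ∈ A × y ≢ x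
  1<∣A∣⇒∃≢ {A = A} {x} x∈A 1<∣A∣ with 0<∣A∣⇒∃∈ {A = A ─ ⁅ x ⁆} 0<∣A─x∣
    where
    0<∣A─x∣ : 0 < ∣ A ─ ⁅ x ⁆ ∣
    0<∣A─x∣ = ℕₚ.+-cancelˡ-< 1 0 ∣ A ─ ⁅ x ⁆ ∣ (begin-strict
      1                                 <⟨ 1<∣A∣ ⟩
      ∣ A ∣                             ≡⟨ ∣A∣≡∣A∩B∣+∣A─B∣ A ⁅ x ⁆ ⟩
      ∣ A ∩ ⁅ x ⁆ ∣ ℕ.+ ∣ A ─ ⁅ x ⁆ ∣   ≤⟨ ℕₚ.+-monoˡ-≤ _ (ℕₚ.≤-trans (A⊆B⇒∣A∣≤∣B∣ {A = A ∩ ⁅ x ⁆} {⁅ x ⁆} (proj₂ ∘ ∈-∩⁻)) (ℕₚ.≤-reflexive (∣⁅x⁆∣≡1 x))) ⟩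
      1 ℕ.+ ∣ A ─ ⁅ x ⁆ ∣               ∎)
      where open ℕₚ.≤-Reasoning
  ... | y , y∈A─x = y , Product.map₂ (λ y∉x y≡x → y∉x (∈-⟦⟧⁺ (Finₚ._≟ x) y≡x)) (∈-─⁻ y∈A─x)

module PrimeField (p : ℕ) (p-prime : Prime p) where
  open ≡ using (refl; sym; trans; cong; cong₂; subst; module ≡-Reasoning)
  open ≡-Reasoning

  instance
    p≢0 : NonZero p
    p≢0 = prime⇒nonZero p-prime

  open IntegersModulo p public using ([_]; toℕ-[]; []-toℕ; []-homo-+; []-homo-*)
  open IntegersModulo p using ([n]≡0ₙ; ℤ/nℤ)

  𝔽 : Set
  𝔽 = Fin p

  𝔽ₚ : CommutativeRing _ _
  𝔽ₚ = ℤ/nℤ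

  open CommutativeRing 𝔽ₚ public
    using ( _+_; _*_; -_; _-_; 0#; 1#; +-assoc; +-comm; +-identityˡ; +-identityʳ
          ; -‿inverseʳ; *-assoc; *-comm; *-identityˡ; *-identityʳ
          ; distribˡ; distribʳ; zeroˡ; zeroʳ; +-group)
  open RingOps 𝔽ₚ public using (pow; sumFin; evalMonic)
  open RingOpsProperties 𝔽ₚ public using (pow-assoc; pow-distrib-*; pow-1#; pow-0#; evalMonic-divide)
  open import Algebra.Properties.Ring (CommutativeRing.ring 𝔽ₚ) public
    using (-‿distribˡ-*; -‿distribʳ-*; -‿involutive; -0#≈0#)
  open import Algebra.Properties.Group +-group public
    using (//-rightDividesˡ; //-rightDividesʳ; x∙y⁻¹≈ε⇒x≈y; inverseʳ-unique)
  open import Algebra.Properties.AbelianGroup (CommutativeRing.+-abelianGroup 𝔽ₚ) public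
    using (⁻¹-anti-homo‿-)

  _≟_ : (a b : 𝔽) → Dec (a ≡ b)
  _≟_ = Finₚ._≟_

  x+[y-x]≡y : ∀ x y → x + (y - x) ≡ y
  x+[y-x]≡y x y = trans (+-comm x (y - x)) (//-rightDividesˡ x y)

  x+y-x≡y : ∀ x y → (x + y) - x ≡ y
  x+y-x≡y x y = trans (cong (_- x) (+-comm x y)) (//-rightDividesʳ x y)

  x-[x-y]≡y : ∀ x y → x - (x - y) ≡ y
  x-[x-y]≡y x y = trans (cong (x +_) (⁻¹-anti-homo‿- x y)) (x+[y-x]≡y x y)

  toℕ-0# : toℕ 0# ≡ 0
  toℕ-0# = trans (toℕ-[] 0) (m<n⇒m%n≡m (ℕ.>-nonZero⁻¹ p))

  1<p : 1 < p
  1<p = ℕ.nonTrivial⇒n>1 p {{prime⇒nonTrivial p-prime}}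

  toℕ-1# : toℕ 1# ≡ 1
  toℕ-1# = trans (toℕ-[] 1) (m<n⇒m%n≡m 1<p)

  1#≢0# : 1# ≢ 0#
  1#≢0# 1≡0 with trans (sym toℕ-1#) (trans (cong toℕ 1≡0) toℕ-0#)
  ... | ()

  [k*p]≡0# : ∀ k → [ k ℕ.* p ] ≡ 0#
  [k*p]≡0# k = trans ([]-homo-* k p) (trans (cong ([ k ] *_) [n]≡0ₙ) (zeroʳ [ k ]))

  p∣toℕ⇒≡0# : ∀ {a} → p ∣ toℕ a → a ≡ 0#
  p∣toℕ⇒≡0# {a} p∣a = Finₚ.toℕ-injective (begin
    toℕ a           ≡⟨ m<n⇒m%n≡m (Finₚ.toℕ<n a) ⟨
    toℕ a ℕ.% p     ≡⟨ n∣m⇒m%n≡0 (toℕ a) p p∣a ⟩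
    0               ≡⟨ toℕ-0# ⟨
    toℕ 0#          ∎)

  *≡0⇒≡0 : ∀ {a b} → a * b ≡ 0# → a ≡ 0# ⊎ b ≡ 0#
  *≡0⇒≡0 {a} {b} ab≡0 with euclidsLemma (toℕ a) (toℕ b) p-prime p∣ab
    where
    p∣ab : p ∣ toℕ a ℕ.* toℕ b
    p∣ab = m%n≡0⇒n∣m _ p (trans (sym (toℕ-[] (toℕ a ℕ.* toℕ b))) (trans (cong toℕ ab≡0) toℕ-0#))
  ... | inj₁ p∣a = inj₁ (p∣toℕ⇒≡0# p∣a)
  ... | inj₂ p∣b = inj₂ (p∣toℕ⇒≡0# p∣b)

  *-≢0 : ∀ {a b} → a ≢ 0# → b ≢ 0# → a * b ≢ 0#
  *-≢0 a≢0 b≢0 ab≡0 with *≡0⇒≡0 ab≡0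
  ... | inj₁ a≡0 = a≢0 a≡0
  ... | inj₂ b≡0 = b≢0 b≡0

  *-cancelʳ-≢0 : ∀ {x y} a → a ≢ 0# → x * a ≡ y * a → x ≡ y
  *-cancelʳ-≢0 {x} {y} a a≢0 xa≡ya with *≡0⇒≡0 [x-y]a≡0
    where
    [x-y]a≡0 : (x - y) * a ≡ 0#
    [x-y]a≡0 = begin
      (x - y) * a       ≡⟨ distribʳ a x (- y) ⟩
      x * a + - y * a   ≡⟨ cong₂ _+_ xa≡ya (sym (-‿distribˡ-* y a)) ⟩
      y * a - y * a     ≡⟨ -‿inverseʳ (y * a) ⟩
      0#                ∎
  ... | inj₁ x-y≡0 = x∙y⁻¹≈ε⇒x≈y x y x-y≡0
  ... | inj₂ a≡0   = ⊥-elim (a≢0 a≡0)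

  inverse : ∀ a → a ≢ 0# → ∃ λ b → a * b ≡ 1#
  inverse a a≢0 with coprime-Bézout a⊥p
    where
    a⊥p : Coprime (toℕ a) p
    a⊥p (d∣a , d∣p) with prime⇒irreducible p-prime d∣p
    ... | inj₁ d≡1   = d≡1
    ... | inj₂ refl = ⊥-elim (a≢0 (p∣toℕ⇒≡0# d∣a))
  ... | Bézout.+- x y 1+yp≡xa = [ x ] , (begin
    a * [ x ]              ≡⟨ cong (_* [ x ]) ([]-toℕ a) ⟨
    [ toℕ a ] * [ x ]      ≡⟨ []-homo-* (toℕ a) x ⟨
    [ toℕ a ℕ.* x ]        ≡⟨ cong [_] (trans (ℕₚ.*-comm (toℕ a) x) (sym 1+yp≡xa)) ⟩
    [ 1 ℕ.+ y ℕ.* p ]      ≡⟨ []-homo-+ 1 (y ℕ.* p) ⟩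
    1# + [ y ℕ.* p ]       ≡⟨ cong (1# +_) ([k*p]≡0# y) ⟩
    1# + 0#                ≡⟨ +-identityʳ 1# ⟩
    1#                     ∎)
  ... | Bézout.-+ x y 1+xa≡yp = - [ x ] , (begin
    a * - [ x ]            ≡⟨ -‿distribʳ-* a [ x ] ⟨
    - (a * [ x ])          ≡⟨ cong -_ (inverseʳ-unique 1# (a * [ x ]) 1+ax≡0) ⟩
    - - 1#                 ≡⟨ -‿involutive 1# ⟩
    1#                     ∎)
    where
    1+ax≡0 : 1# + a * [ x ] ≡ 0#
    1+ax≡0 = begin
      1# + a * [ x ]         ≡⟨ cong (λ b → 1# + b * [ x ]) ([]-toℕ a) ⟨
      1# + [ toℕ a ] * [ x ] ≡⟨ cong (1# +_) ([]-homo-* (toℕ a) x) ⟨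
      [ 1 ] + [ toℕ a ℕ.* x ] ≡⟨ []-homo-+ 1 (toℕ a ℕ.* x) ⟨
      [ 1 ℕ.+ toℕ a ℕ.* x ]  ≡⟨ cong (λ k → [ 1 ℕ.+ k ]) (ℕₚ.*-comm (toℕ a) x) ⟩
      [ 1 ℕ.+ x ℕ.* toℕ a ]  ≡⟨ cong [_] 1+xa≡yp ⟩
      [ y ℕ.* p ]            ≡⟨ [k*p]≡0# y ⟩
      0#                     ∎

  unit-cancel : ∀ u v → u * v ≡ 1# → ∀ x → u * (v * x) ≡ x
  unit-cancel u v uv≡1 x = trans (sym (*-assoc u v x)) (trans (cong (_* x) uv≡1) (*-identityˡ x))

  *-permutation : ∀ {a b} → a * b ≡ 1# → Permutation p p
  *-permutation {a} {b} ab≡1 =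
    permutation (a *_) (b *_) (unit-cancel a b ab≡1) (unit-cancel b a (trans (*-comm b a) ab≡1))

module Units (p : ℕ) (p-prime : Prime p) where
  open ≡ using (refl; sym; trans; cong; cong₂; module ≡-Reasoning)
  open ≡-Reasoning
  open PrimeField p p-prime
  open FinSubsets
  open import Algebra.Properties.CommutativeMonoid.Sum (CommutativeRing.*-commutativeMonoid 𝔽ₚ)
    using () renaming (sum to ∏; sum-cong-≗ to ∏-cong; ∑-distrib-+ to ∏-distrib-*; sum-permute to ∏-permute)

  𝔽* : Subset p
  𝔽* = ∁ ⁅ 0# ⁆

  ≢0⇒∈𝔽* : ∀ {x} → x ≢ 0# → x ∈ 𝔽*
  ≢0⇒∈𝔽* x≢0 = ∈-∁⁺ (x≢0 ∘ ∈-⟦⟧⁻ (_≟ 0#))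

  ∈𝔽*⇒≢0 : ∀ {x} → x ∈ 𝔽* → x ≢ 0#
  ∈𝔽*⇒≢0 x∈𝔽* x≡0 = ∈-∁⁻ x∈𝔽* (∈-⟦⟧⁺ (_≟ 0#) x≡0)

  ∉𝔽*⇒≡0 : ∀ {x} → x ∉ 𝔽* → x ≡ 0#
  ∉𝔽*⇒≡0 {x} x∉𝔽* = decidable-stable (x ≟ 0#) (x∉𝔽* ∘ ≢0⇒∈𝔽*)

  ∣𝔽*∣≡p-1 : ∣ 𝔽* ∣ ≡ p ∸ 1
  ∣𝔽*∣≡p-1 = begin
    ∣ 𝔽* ∣                       ≡⟨ ℕₚ.m+n∸m≡n 1 ∣ 𝔽* ∣ ⟨
    1 ℕ.+ ∣ 𝔽* ∣ ∸ 1             ≡⟨ cong (λ k → k ℕ.+ ∣ 𝔽* ∣ ∸ 1) (∣⁅x⁆∣≡1 0#) ⟨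
    ∣ ⁅ 0# ⁆ ∣ ℕ.+ ∣ 𝔽* ∣ ∸ 1    ≡⟨ cong (_∸ 1) (∣A∣+∣∁A∣≡n ⁅ 0# ⁆) ⟩
    p ∸ 1                        ∎

  ∏-≢0 : ∀ {n} (f : Fin n → 𝔽) → (∀ x → f x ≢ 0#) → ∏ f ≢ 0#
  ∏-≢0 {zero}  f f≢0 = 1#≢0#
  ∏-≢0 {suc n} f f≢0 = *-≢0 (f≢0 Fin.zero) (∏-≢0 (f ∘ Fin.suc) (f≢0 ∘ Fin.suc))

  ∏-indicator : ∀ {n} (A : Subset n) a → ∏ (λ x → if A x then a else 1#) ≡ pow a ∣ A ∣
  ∏-indicator {zero}  A a = refl
  ∏-indicator {suc n} A a with A Fin.zero
  ... | true  = cong (a *_) (∏-indicator (A ∘ Fin.suc) a)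
  ... | false = trans (*-identityˡ _) (∏-indicator (A ∘ Fin.suc) a)

  -- Multiplying by a permutes the units, so the product of all units absorbs a^(p-1).
  fermat : ∀ {a} → a ≢ 0# → pow a (p ∸ 1) ≡ 1#
  fermat {a} a≢0 = *-cancelʳ-≢0 P (∏-≢0 unitOr1 unitOr1≢0) (begin
    pow a (p ∸ 1) * P                      ≡⟨ cong (λ k → pow a k * P) ∣𝔽*∣≡p-1 ⟨
    pow a ∣ 𝔽* ∣ * P                       ≡⟨ cong (_* P) (∏-indicator 𝔽* a) ⟨
    ∏ aOr1 * P                             ≡⟨ ∏-distrib-* aOr1 unitOr1 ⟨
    ∏ (λ x → aOr1 x * unitOr1 x)           ≡⟨ ∏-cong unitOr1-scale ⟨
    ∏ (λ x → unitOr1 (a * x))              ≡⟨ ∏-permute unitOr1 (*-permutation {a} a*a⁻¹≡1) ⟨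
    P                                      ≡⟨ *-identityˡ P ⟨
    1# * P                                 ∎)
    where
    a*a⁻¹≡1 = proj₂ (inverse a a≢0)
    unitOr1 aOr1 : 𝔽 → 𝔽
    unitOr1 x = if 𝔽* x then x else 1#
    aOr1 x = if 𝔽* x then a else 1#
    P = ∏ unitOr1
    unitOr1≢0 : ∀ x → unitOr1 x ≢ 0#
    unitOr1≢0 x with 𝔽* x in x∈?
    ... | true  = ∈𝔽*⇒≢0 (≡true⇒∈ {A = 𝔽*} x∈?)
    ... | false = 1#≢0#
    unitOr1-scale : ∀ x → unitOr1 (a * x) ≡ aOr1 x * unitOr1 x
    unitOr1-scale x with 𝔽* x in x∈? | 𝔽* (a * x) in ax∈?
    ... | true  | true  = refl
    ... | false | false = sym (*-identityˡ 1#)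
    ... | true  | false = ⊥-elim (≡false⇒∉ {A = 𝔽*} ax∈? (≢0⇒∈𝔽* (*-≢0 a≢0 (∈𝔽*⇒≢0 (≡true⇒∈ {A = 𝔽*} x∈?)))))
    ... | false | true  = ⊥-elim (∈𝔽*⇒≢0 (≡true⇒∈ {A = 𝔽*} ax∈?)
                            (trans (cong (a *_) (∉𝔽*⇒≡0 (≡false⇒∉ {A = 𝔽*} x∈?))) (zeroʳ a)))

module PolynomialRoots (p : ℕ) (p-prime : Prime p) where
  open ≡ using (refl; sym; trans; cong; module ≡-Reasoning)
  open PrimeField p p-prime
  open FinSubsets

  root? : ∀ cs x → Dec (evalMonic cs x ≡ 0#)
  root? cs x = evalMonic cs x ≟ 0#

  roots : List 𝔽 → Subset p
  roots cs = ⟦ root? cs ⟧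

  roots⊆root∪roots-quotient : ∀ {cs r} q → r ∈ roots cs →
    (∀ x → evalMonic cs x ≡ (x - r) * evalMonic q x + evalMonic cs r) →
    roots cs ⊆ ⁅ r ⁆ ∪ roots q
  roots⊆root∪roots-quotient {cs} {r} q r∈roots division {x} x∈roots with *≡0⇒≡0 [x-r]q≡0
    where
    open ≡-Reasoning
    [x-r]q≡0 : (x - r) * evalMonic q x ≡ 0#
    [x-r]q≡0 = begin
      (x - r) * evalMonic q x                 ≡⟨ +-identityʳ _ ⟨
      (x - r) * evalMonic q x + 0#            ≡⟨ cong ((x - r) * evalMonic q x +_) (∈-⟦⟧⁻ (root? cs) r∈roots) ⟨
      (x - r) * evalMonic q x + evalMonic cs r ≡⟨ division x ⟨
      evalMonic cs x                          ≡⟨ ∈-⟦⟧⁻ (root? cs) x∈roots ⟩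
      0#                                      ∎
  ... | inj₁ x-r≡0  = ∈-∪⁺ˡ (∈-⟦⟧⁺ (Finₚ._≟ r) (x∙y⁻¹≈ε⇒x≈y x r x-r≡0))
  ... | inj₂ q[x]≡0 = ∈-∪⁺ʳ (∈-⟦⟧⁺ (root? q) q[x]≡0)

  ∣roots∣≤degree : ∀ cs → ∣ roots cs ∣ ≤ length cs
  ∣roots∣≤degree cs = ∣roots∣≤ (length cs) cs refl
    where
    ∣roots∣≤ : ∀ n cs → length cs ≡ n → ∣ roots cs ∣ ≤ n
    ∣roots∣≤ zero [] _ = ℕₚ.≤-reflexive (∀∉⇒∣A∣≡0 (roots []) (λ _ → 1#≢0# ∘ ∈-⟦⟧⁻ (root? [])))
    ∣roots∣≤ (suc n) (c ∷ cs) |c∷cs|≡1+n with Finₚ.any? (_∈? roots (c ∷ cs))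
    ... | no ∄root = ℕₚ.≤-trans (ℕₚ.≤-reflexive (∀∉⇒∣A∣≡0 (roots (c ∷ cs)) (λ x x∈ → ∄root (x , x∈)))) z≤n
    ... | yes (r , r∈roots) with evalMonic-divide c cs r
    ... | q , |q|≡|cs| , division = begin
      ∣ roots (c ∷ cs) ∣          ≤⟨ A⊆B⇒∣A∣≤∣B∣ (roots⊆root∪roots-quotient {c ∷ cs} q r∈roots division) ⟩
      ∣ ⁅ r ⁆ ∪ roots q ∣         ≤⟨ ∣A∪B∣≤∣A∣+∣B∣ ⁅ r ⁆ (roots q) ⟩
      ∣ ⁅ r ⁆ ∣ ℕ.+ ∣ roots q ∣   ≤⟨ ℕₚ.+-mono-≤ (ℕₚ.≤-reflexive (∣⁅x⁆∣≡1 r)) (∣roots∣≤ n q |q|≡n) ⟩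
      suc n                       ∎
      where
      open ℕₚ.≤-Reasoning
      |q|≡n = trans |q|≡|cs| (ℕₚ.suc-injective |c∷cs|≡1+n)

module RootsOfUnity (p : ℕ) (p-prime : Prime p) (m : ℕ) where
  open ≡ using (refl; sym; trans; cong; cong₂; module ≡-Reasoning)
  open PrimeField p p-prime
  open FinSubsets
  open Units p p-prime using (𝔽*; ≢0⇒∈𝔽*; ∈𝔽*⇒≢0; ∣𝔽*∣≡p-1; fermat)
  open PolynomialRoots p p-prime using (roots; root?; ∣roots∣≤degree)
  open RingOpsProperties 𝔽ₚ using (geometric; length-geometric; geometric-sum)

  unity? : ∀ y → Dec (pow y m ≡ 1#)
  unity? y = pow y m ≟ 1#

  μ : Subset p
  μ = ⟦ unity? ⟧

  ∈μ⁺ : ∀ {y} → pow y m ≡ 1# → y ∈ μ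
  ∈μ⁺ = ∈-⟦⟧⁺ unity?

  ∈μ⁻ : ∀ {y} → y ∈ μ → pow y m ≡ 1#
  ∈μ⁻ = ∈-⟦⟧⁻ unity?

  1∈μ : 1# ∈ μ
  1∈μ = ∈μ⁺ (pow-1# m)

  μ-*-closed : ∀ {x y} → x ∈ μ → y ∈ μ → x * y ∈ μ
  μ-*-closed {x} {y} x∈μ y∈μ = ∈μ⁺ (begin
    pow (x * y) m         ≡⟨ pow-distrib-* x y m ⟩
    pow x m * pow y m     ≡⟨ cong₂ _*_ (∈μ⁻ x∈μ) (∈μ⁻ y∈μ) ⟩
    1# * 1#               ≡⟨ *-identityˡ 1# ⟩
    1#                    ∎)
    where open ≡-Reasoning

  μ-inverse-closed : ∀ {x y} → x ∈ μ → x * y ≡ 1# → y ∈ μ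
  μ-inverse-closed {x} {y} x∈μ xy≡1 = ∈μ⁺ (begin
    pow y m               ≡⟨ *-identityˡ (pow y m) ⟨
    1# * pow y m          ≡⟨ cong (_* pow y m) (∈μ⁻ x∈μ) ⟨
    pow x m * pow y m     ≡⟨ pow-distrib-* x y m ⟨
    pow (x * y) m         ≡⟨ cong (λ z → pow z m) xy≡1 ⟩
    pow 1# m              ≡⟨ pow-1# m ⟩
    1#                    ∎)
    where open ≡-Reasoning

  ∈μ⇒≢0 : .{{_ : NonZero m}} → ∀ {x} → x ∈ μ → x ≢ 0#
  ∈μ⇒≢0 {x} x∈μ x≡0 = 1#≢0# (trans (sym (∈μ⁻ x∈μ)) (trans (cong (λ z → pow z m) x≡0) (pow-0# m)))

  module _ .{{_ : NonZero m}} (e : ℕ) (p-1≡[1+e]m : p ∸ 1 ≡ suc e ℕ.* m) where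
    cofactor : List 𝔽
    cofactor = geometric (ℕ.pred m) e

    length-cofactor : length cofactor ≡ e ℕ.* m
    length-cofactor = trans (length-geometric (ℕ.pred m) e) (cong (e ℕ.*_) (ℕₚ.suc-pred m))

    -- With Y = y^m: Y G(y) + 1 = G(y) + Y^(e+1), and Y^(e+1) = y^(p-1) = 1 for a unit y.
    y^m*cofactor≡cofactor : ∀ {y} → y ∈ 𝔽* → pow y m * evalMonic cofactor y ≡ evalMonic cofactor y
    y^m*cofactor≡cofactor {y} y∈𝔽* = begin
      Y * g                      ≡⟨ //-rightDividesʳ 1# (Y * g) ⟨
      (Y * g + 1#) - 1#          ≡⟨ cong (_- 1#) Yg+1≡g+Y^[1+e] ⟩
      (g + pow Y (suc e)) - 1#   ≡⟨ cong (λ z → (g + z) - 1#) Y^[1+e]≡1 ⟩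
      (g + 1#) - 1#              ≡⟨ //-rightDividesʳ 1# g ⟩
      g                          ∎
      where
      open ≡-Reasoning
      Y = pow y m
      g = evalMonic cofactor y
      Yg+1≡g+Y^[1+e] : Y * g + 1# ≡ g + pow Y (suc e)
      Yg+1≡g+Y^[1+e] = ≡.subst (λ k → pow y k * g + 1# ≡ g + pow (pow y k) (suc e))
                                (ℕₚ.suc-pred m) (geometric-sum (ℕ.pred m) e y)
      Y^[1+e]≡1 : pow Y (suc e) ≡ 1#
      Y^[1+e]≡1 = trans (pow-assoc y m (suc e))
        (trans (cong (pow y) (trans (ℕₚ.*-comm m (suc e)) (sym p-1≡[1+e]m))) (fermat (∈𝔽*⇒≢0 y∈𝔽*)))

    𝔽*⊆μ∪roots[cofactor] : 𝔽* ⊆ μ ∪ roots cofactor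
    𝔽*⊆μ∪roots[cofactor] {y} y∈𝔽* with root? cofactor y
    ... | yes G[y]≡0 = ∈-∪⁺ʳ (∈-⟦⟧⁺ (root? cofactor) G[y]≡0)
    ... | no  G[y]≢0 = ∈-∪⁺ˡ (∈μ⁺ (*-cancelʳ-≢0 (evalMonic cofactor y) G[y]≢0
                          (trans (y^m*cofactor≡cofactor y∈𝔽*) (sym (*-identityˡ (evalMonic cofactor y))))))

  m≤∣μ∣ : .{{_ : NonZero m}} → m ∣ p ∸ 1 → m ≤ ∣ μ ∣
  m≤∣μ∣ (divides zero p-1≡0) = ⊥-elim (ℕₚ.<⇒≢ (ℕₚ.m<n⇒0<n∸m 1<p) (sym p-1≡0))
  m≤∣μ∣ (divides (suc e) p-1≡[1+e]m) = ℕₚ.+-cancelʳ-≤ (e ℕ.* m) m ∣ μ ∣ (begin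
    m ℕ.+ e ℕ.* m            ≡⟨ trans (sym p-1≡[1+e]m) (sym ∣𝔽*∣≡p-1) ⟩
    ∣ 𝔽* ∣                   ≤⟨ A⊆B⇒∣A∣≤∣B∣ (𝔽*⊆μ∪roots[cofactor] e p-1≡[1+e]m) ⟩
    ∣ μ ∪ roots G ∣          ≤⟨ ∣A∪B∣≤∣A∣+∣B∣ μ (roots G) ⟩
    ∣ μ ∣ ℕ.+ ∣ roots G ∣    ≤⟨ ℕₚ.+-monoʳ-≤ ∣ μ ∣ (∣roots∣≤degree G) ⟩
    ∣ μ ∣ ℕ.+ length G       ≡⟨ cong (∣ μ ∣ ℕ.+_) (length-cofactor e p-1≡[1+e]m) ⟩
    ∣ μ ∣ ℕ.+ e ℕ.* m        ∎)
    where
    open ℕₚ.≤-Reasoning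
    G = cofactor e p-1≡[1+e]m

module CauchyDavenport (p : ℕ) (p-prime : Prime p) where
  open ≡ using (refl; sym; trans; cong; cong₂; subst; module ≡-Reasoning)
  open PrimeField p p-prime
  open FinSubsets
  open import Algebra.Solver.Ring.NaturalCoefficients.Default (CommutativeRing.commutativeSemiring 𝔽ₚ)
    using (solve; _:+_; _:*_; _:=_; con)

  infixl 6 _⊕_

  sum? : ∀ A B y → Dec (∃ λ z → z ∈ A × y - z ∈ B)
  sum? A B y = Finₚ.any? (λ z → z ∈? A ×-dec (y - z) ∈? B)

  _⊕_ : Subset p → Subset p → Subset p
  A ⊕ B = ⟦ sum? A B ⟧

  ∈-⊕⁺ : ∀ {A B a b} → a ∈ A → b ∈ B → a + b ∈ A ⊕ B
  ∈-⊕⁺ {A} {B} {a} {b} a∈A b∈B = ∈-⟦⟧⁺ (sum? A B) (a , a∈A , subst (_∈ B) (sym (x+y-x≡y a b)) b∈B)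

  ∈-⊕⁻ : ∀ {A B y} → y ∈ A ⊕ B → ∃ λ z → z ∈ A × y - z ∈ B
  ∈-⊕⁻ {A} {B} = ∈-⟦⟧⁻ (sum? A B)

  translate : 𝔽 → Subset p → Subset p
  translate t A y = A (y - t)

  ∈-translate⁺ : ∀ t {A y} → y - t ∈ A → y ∈ translate t A
  ∈-translate⁺ t (mk∈ y-t∈A) = mk∈ y-t∈A

  ∈-translate⁻ : ∀ t {A y} → y ∈ translate t A → y - t ∈ A
  ∈-translate⁻ t (mk∈ y-t∈A) = mk∈ y-t∈A

  ∣translate∣ : ∀ t A → ∣ translate t A ∣ ≡ ∣ A ∣
  ∣translate∣ t A = ∣∣-permute A (permutation (_- t) (_+ t) (//-rightDividesʳ t) (//-rightDividesˡ t))

  ∣A∣≤∣A⊕B∣ : ∀ {A B b} → b ∈ B → ∣ A ∣ ≤ ∣ A ⊕ B ∣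
  ∣A∣≤∣A⊕B∣ {A} {B} {b} b∈B = begin
    ∣ A ∣              ≡⟨ ∣translate∣ b A ⟨
    ∣ translate b A ∣  ≤⟨ A⊆B⇒∣A∣≤∣B∣ b+A⊆A⊕B ⟩
    ∣ A ⊕ B ∣          ∎
    where
    open ℕₚ.≤-Reasoning
    b+A⊆A⊕B : translate b A ⊆ A ⊕ B
    b+A⊆A⊕B {y} y∈b+A = subst (_∈ A ⊕ B) (//-rightDividesˡ b y) (∈-⊕⁺ (∈-translate⁻ b y∈b+A) b∈B)

  -- A set containing a and closed under x ↦ x + δ contains a + kδ for every k, which is everything.
  step-closed⇒full : ∀ {A a δ} → a ∈ A → δ ≢ 0# → (∀ {x} → x ∈ A → x + δ ∈ A) → ∀ y → y ∈ A
  step-closed⇒full {A} {a} {δ} a∈A δ≢0 step y = subst (_∈ A) a+cδ≡y (iterate (toℕ c))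
    where
    open ≡-Reasoning
    δ⁻¹ = proj₁ (inverse δ δ≢0)
    c = (y - a) * δ⁻¹
    iterate : ∀ k → a + [ k ] * δ ∈ A
    iterate zero    = subst (_∈ A) (sym (trans (cong (a +_) (zeroˡ δ)) (+-identityʳ a))) a∈A
    iterate (suc k) = subst (_∈ A) (sym (begin
      a + [ 1 ℕ.+ k ] * δ       ≡⟨ cong (λ K → a + K * δ) ([]-homo-+ 1 k) ⟩
      a + (1# + [ k ]) * δ      ≡⟨ solve 3 (λ a K d → a :+ (con 1 :+ K) :* d := (a :+ K :* d) :+ d) refl a [ k ] δ ⟩
      (a + [ k ] * δ) + δ       ∎)) (step (iterate k))
    a+cδ≡y : a + [ toℕ c ] * δ ≡ y
    a+cδ≡y = begin
      a + [ toℕ c ] * δ         ≡⟨ cong (λ K → a + K * δ) ([]-toℕ c) ⟩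
      a + (y - a) * δ⁻¹ * δ     ≡⟨ cong (a +_) (*-assoc (y - a) δ⁻¹ δ) ⟩
      a + (y - a) * (δ⁻¹ * δ)   ≡⟨ cong (λ u → a + (y - a) * u) (trans (*-comm δ⁻¹ δ) (proj₂ (inverse δ δ≢0))) ⟩
      a + (y - a) * 1#          ≡⟨ cong (a +_) (*-identityʳ (y - a)) ⟩
      a + (y - a)               ≡⟨ x+[y-x]≡y a y ⟩
      y                         ∎

  ⊕-∪∩ : ∀ A C → (A ∪ C) ⊕ (A ∩ C) ⊆ A ⊕ C
  ⊕-∪∩ A C {y} y∈ with ∈-⊕⁻ {A ∪ C} {A ∩ C} y∈
  ... | z , z∈A∪C , y-z∈A∩C with ∈-∪⁻ z∈A∪C | ∈-∩⁻ y-z∈A∩C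
  ... | inj₁ z∈A | _ , y-z∈C = subst (_∈ A ⊕ C) (x+[y-x]≡y z y) (∈-⊕⁺ z∈A y-z∈C)
  ... | inj₂ z∈C | y-z∈A , _ = subst (_∈ A ⊕ C) (//-rightDividesˡ z y) (∈-⊕⁺ y-z∈A z∈C)

  ⊕-translate : ∀ t A B → A ⊕ translate t B ⊆ translate t (A ⊕ B)
  ⊕-translate t A B {y} y∈ with ∈-⊕⁻ {A} {translate t B} y∈
  ... | z , z∈A , y-z∈t+B = ∈-translate⁺ t (subst (_∈ A ⊕ B) z+[y-z-t]≡y-t (∈-⊕⁺ z∈A (∈-translate⁻ t y-z∈t+B)))
    where
    z+[y-z-t]≡y-t : z + ((y - z) - t) ≡ y - t
    z+[y-z-t]≡y-t = trans (sym (+-assoc z (y - z) (- t))) (cong (_- t) (x+[y-x]≡y z y))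

  module _ {A B : Subset p} {a b : 𝔽} where
    private
      C = translate (a - b) B

    a∈A∩[a-b+B] : a ∈ A → b ∈ B → a ∈ A ∩ C
    a∈A∩[a-b+B] a∈A b∈B = ∈-∩⁺ a∈A (∈-translate⁺ (a - b) (subst (_∈ B) (sym (x-[x-y]≡y a b)) b∈B))

    ∣A∩[a-b+B]∣<∣B∣ : ∀ {b₂} → b₂ ∈ B → a + (b₂ - b) ∉ A → ∣ A ∩ C ∣ < ∣ B ∣
    ∣A∩[a-b+B]∣<∣B∣ {b₂} b₂∈B a+δ∉A = ℕₚ.<-≤-trans
      (A⊂B⇒∣A∣<∣B∣ {A = A ∩ C} {C} (proj₂ ∘ ∈-∩⁻) (∈-translate⁺ (a - b) (subst (_∈ B) (sym a+δ-t≡b₂) b₂∈B))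
                   (a+δ∉A ∘ proj₁ ∘ ∈-∩⁻))
      (ℕₚ.≤-reflexive (∣translate∣ (a - b) B))
      where
      open ≡-Reasoning
      a+δ-t≡b₂ : (a + (b₂ - b)) - (a - b) ≡ b₂
      a+δ-t≡b₂ = begin
        (a + (b₂ - b)) - (a - b)     ≡⟨ cong (_- (a - b)) (+-comm a (b₂ - b)) ⟩
        ((b₂ - b) + a) - (a - b)     ≡⟨ +-assoc (b₂ - b) a (- (a - b)) ⟩
        (b₂ - b) + (a - (a - b))     ≡⟨ cong ((b₂ - b) +_) (x-[x-y]≡y a b) ⟩
        (b₂ - b) + b                 ≡⟨ //-rightDividesˡ b b₂ ⟩
        b₂                           ∎

  ∣A∪[t+B]∣+∣A∩[t+B]∣≡∣A∣+∣B∣ : ∀ t A B → ∣ A ∪ translate t B ∣ ℕ.+ ∣ A ∩ translate t B ∣ ≡ ∣ A ∣ ℕ.+ ∣ B ∣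
  ∣A∪[t+B]∣+∣A∩[t+B]∣≡∣A∣+∣B∣ t A B =
    trans (∣A∪B∣+∣A∩B∣≡∣A∣+∣B∣ A (translate t B)) (cong (∣ A ∣ ℕ.+_) (∣translate∣ t B))

  ∣[A∪[t+B]]⊕[A∩[t+B]]∣≤∣A⊕B∣ : ∀ t A B → ∣ (A ∪ translate t B) ⊕ (A ∩ translate t B) ∣ ≤ ∣ A ⊕ B ∣
  ∣[A∪[t+B]]⊕[A∩[t+B]]∣≤∣A⊕B∣ t A B = ℕₚ.≤-trans
    (A⊆B⇒∣A∣≤∣B∣ (⊕-translate t A B ∘ ⊕-∪∩ A (translate t B)))
    (ℕₚ.≤-reflexive (∣translate∣ t (A ⊕ B)))

  -- Induction on |B| through Davenport's transform (A, B) ↦ (A ∪ C, A ∩ C) with C = (a - b) + B, which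
  -- preserves |A| + |B|, does not enlarge the sumset, and shrinks B when a ∈ A but a + (b₂ - b) ∉ A.
  cauchy-davenport : ∀ {A B a b} → a ∈ A → b ∈ B → p ≤ ∣ A ⊕ B ∣ ⊎ ∣ A ∣ ℕ.+ ∣ B ∣ ≤ suc ∣ A ⊕ B ∣
  cauchy-davenport {B = B} = by-induction ∣ B ∣ ℕₚ.≤-refl
    where
    by-induction : ∀ k {A B a b} → ∣ B ∣ ≤ k → a ∈ A → b ∈ B → p ≤ ∣ A ⊕ B ∣ ⊎ ∣ A ∣ ℕ.+ ∣ B ∣ ≤ suc ∣ A ⊕ B ∣
    by-induction zero    ∣B∣≤0 _ b∈B = ⊥-elim (ℕₚ.<⇒≱ (x∈A⇒0<∣A∣ b∈B) ∣B∣≤0)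
    by-induction (suc k) {A} {B} {a} {b} ∣B∣≤1+k a∈A b∈B with ∣ B ∣ ℕ.≤? 1
    ... | yes ∣B∣≤1 = inj₂ (ℕₚ.≤-trans (ℕₚ.+-mono-≤ (∣A∣≤∣A⊕B∣ b∈B) ∣B∣≤1) (ℕₚ.≤-reflexive (ℕₚ.+-comm _ 1)))
    ... | no  ∣B∣≰1 with 1<∣A∣⇒∃≢ b∈B (ℕₚ.≰⇒> ∣B∣≰1)
    ... | b₂ , b₂∈B , b₂≢b with Finₚ.any? (λ x → x ∈? A ×-dec ¬? ((x + (b₂ - b)) ∈? A))
    ... | no ∄exit = inj₁ (begin
      p           ≡⟨ ∀∈⇒∣A∣≡n A A-full ⟨
      ∣ A ∣       ≤⟨ ∣A∣≤∣A⊕B∣ b∈B ⟩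
      ∣ A ⊕ B ∣   ∎)
      where
      open ℕₚ.≤-Reasoning
      A-full : ∀ y → y ∈ A
      A-full = step-closed⇒full a∈A (b₂≢b ∘ x∙y⁻¹≈ε⇒x≈y b₂ b)
        (λ {x} x∈A → decidable-stable ((x + (b₂ - b)) ∈? A) (λ x+δ∉A → ∄exit (x , x∈A , x+δ∉A)))
    ... | yes (a′ , a′∈A , a′+δ∉A)
      with by-induction k (ℕₚ.≤-pred (ℕₚ.<-≤-trans (∣A∩[a-b+B]∣<∣B∣ {A} {B} {a′} {b} b₂∈B a′+δ∉A) ∣B∣≤1+k))
                          (∈-∪⁺ˡ a′∈A) (a∈A∩[a-b+B] a′∈A b∈B)
    ... | inj₁ p≤∣A′⊕B′∣ = inj₁ (ℕₚ.≤-trans p≤∣A′⊕B′∣ (∣[A∪[t+B]]⊕[A∩[t+B]]∣≤∣A⊕B∣ (a′ - b) A B))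
    ... | inj₂ ∣A′∣+∣B′∣≤ = inj₂ (begin
      ∣ A ∣ ℕ.+ ∣ B ∣                  ≡⟨ ∣A∪[t+B]∣+∣A∩[t+B]∣≡∣A∣+∣B∣ (a′ - b) A B ⟨
      ∣ A′ ∣ ℕ.+ ∣ B′ ∣                ≤⟨ ∣A′∣+∣B′∣≤ ⟩
      suc ∣ A′ ⊕ B′ ∣                  ≤⟨ s≤s (∣[A∪[t+B]]⊕[A∩[t+B]]∣≤∣A⊕B∣ (a′ - b) A B) ⟩
      suc ∣ A ⊕ B ∣                    ∎)
      where
      open ℕₚ.≤-Reasoning
      A′ = A ∪ translate (a′ - b) B
      B′ = A ∩ translate (a′ - b) B

module Cosets (p : ℕ) (p-prime : Prime p) (m : ℕ) .{{_ : NonZero m}} where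
  open ≡ using (refl; sym; trans; cong; cong₂; subst; module ≡-Reasoning)
  open PrimeField p p-prime
  open FinSubsets
  open Units p p-prime using (𝔽*; ∈𝔽*⇒≢0)
  open RootsOfUnity p p-prime m

  μ-invariant : Subset p → Set
  μ-invariant X = ∀ {h y} → h ∈ μ → y ∈ X → h * y ∈ X

  module _ (x x⁻¹ : 𝔽) (x*x⁻¹≡1 : x * x⁻¹ ≡ 1#) where
    private
      x⁻¹*x≡1 = trans (*-comm x⁻¹ x) x*x⁻¹≡1

    xμ : Subset p
    xμ y = μ (x⁻¹ * y)

    ∣xμ∣≡∣μ∣ : ∣ xμ ∣ ≡ ∣ μ ∣
    ∣xμ∣≡∣μ∣ = ∣∣-permute μ (*-permutation {x⁻¹} x⁻¹*x≡1)

    x∈xμ : x ∈ xμ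
    x∈xμ = mk∈ (∈-true (subst (_∈ μ) (sym x⁻¹*x≡1) 1∈μ))

    xμ⊆X : ∀ {X} → μ-invariant X → x ∈ X → xμ ⊆ X
    xμ⊆X {X} X-inv x∈X {y} (mk∈ x⁻¹y∈μ) =
      subst (_∈ X) (trans (*-comm (x⁻¹ * y) x) (unit-cancel x x⁻¹ x*x⁻¹≡1 y)) (X-inv (mk∈ x⁻¹y∈μ) x∈X)

    X─xμ-invariant : ∀ {X} → μ-invariant X → μ-invariant (X ─ xμ)
    X─xμ-invariant {X} X-inv {h} {y} h∈μ y∈X─xμ with ∈-─⁻ y∈X─xμ
    ... | y∈X , y∉xμ = ∈-─⁺ (X-inv h∈μ y∈X) (λ (mk∈ x⁻¹hy∈μ) → y∉xμ (mk∈ (∈-true (x⁻¹y∈μ (mk∈ x⁻¹hy∈μ)))))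
      where
      h⁻¹ = proj₁ (inverse h (∈μ⇒≢0 h∈μ))
      hh⁻¹≡1 = proj₂ (inverse h (∈μ⇒≢0 h∈μ))
      x⁻¹y∈μ : x⁻¹ * (h * y) ∈ μ → x⁻¹ * y ∈ μ
      x⁻¹y∈μ x⁻¹hy∈μ = subst (_∈ μ) h⁻¹x⁻¹hy≡x⁻¹y (μ-*-closed (μ-inverse-closed h∈μ hh⁻¹≡1) x⁻¹hy∈μ)
        where
        open ≡-Reasoning
        h⁻¹x⁻¹hy≡x⁻¹y : h⁻¹ * (x⁻¹ * (h * y)) ≡ x⁻¹ * y
        h⁻¹x⁻¹hy≡x⁻¹y = begin
          h⁻¹ * (x⁻¹ * (h * y))   ≡⟨ cong (h⁻¹ *_) (trans (sym (*-assoc x⁻¹ h y)) (trans (cong (_* y) (*-comm x⁻¹ h)) (*-assoc h x⁻¹ y))) ⟩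
          h⁻¹ * (h * (x⁻¹ * y))   ≡⟨ unit-cancel h⁻¹ h (trans (*-comm h⁻¹ h) hh⁻¹≡1) (x⁻¹ * y) ⟩
          x⁻¹ * y                 ∎

  -- A μ-invariant set of units is a disjoint union of cosets of μ.
  ∣μ∣∣∣X∣ : ∀ X → X ⊆ 𝔽* → μ-invariant X → ∣ μ ∣ ∣ ∣ X ∣
  ∣μ∣∣∣X∣ X = by-induction ∣ X ∣ ℕₚ.≤-refl
    where
    by-induction : ∀ k {X} → ∣ X ∣ ≤ k → X ⊆ 𝔽* → μ-invariant X → ∣ μ ∣ ∣ ∣ X ∣
    by-induction zero    ∣X∣≤0 _ _ = subst (∣ μ ∣ ∣_) (sym (ℕₚ.n≤0⇒n≡0 ∣X∣≤0)) (∣ μ ∣ ∣0)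
    by-induction (suc k) {X} ∣X∣≤1+k X⊆𝔽* X-inv with Finₚ.any? (_∈? X)
    ... | no ∄x = subst (∣ μ ∣ ∣_) (sym (∀∉⇒∣A∣≡0 X (λ x x∈X → ∄x (x , x∈X)))) (∣ μ ∣ ∣0)
    ... | yes (x , x∈X) = subst (∣ μ ∣ ∣_) (sym ∣X∣≡∣μ∣+∣X─xμ∣)
            (∣m∣n⇒∣m+n ∣-refl (by-induction k ∣X─xμ∣≤k (X⊆𝔽* ∘ proj₁ ∘ ∈-─⁻) (X─xμ-invariant x x⁻¹ x*x⁻¹≡1 X-inv)))
      where
      x⁻¹ = proj₁ (inverse x (∈𝔽*⇒≢0 (X⊆𝔽* x∈X)))
      x*x⁻¹≡1 = proj₂ (inverse x (∈𝔽*⇒≢0 (X⊆𝔽* x∈X)))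
      xμ′ = xμ x x⁻¹ x*x⁻¹≡1
      ∣X∣≡∣μ∣+∣X─xμ∣ : ∣ X ∣ ≡ ∣ μ ∣ ℕ.+ ∣ X ─ xμ′ ∣
      ∣X∣≡∣μ∣+∣X─xμ∣ = trans (∣A∣≡∣A∩B∣+∣A─B∣ X xμ′)
        (cong (ℕ._+ ∣ X ─ xμ′ ∣) (trans (B⊆A⇒∣A∩B∣≡∣B∣ (xμ⊆X x x⁻¹ x*x⁻¹≡1 X-inv x∈X)) (∣xμ∣≡∣μ∣ x x⁻¹ x*x⁻¹≡1)))
      ∣X─xμ∣≤k : ∣ X ─ xμ′ ∣ ≤ k
      ∣X─xμ∣≤k = ℕₚ.≤-pred (ℕₚ.<-≤-trans
        (A⊂B⇒∣A∣<∣B∣ {A = X ─ xμ′} {X} (proj₁ ∘ ∈-─⁻) x∈X (λ x∈X─xμ → proj₂ (∈-─⁻ x∈X─xμ) (x∈xμ x x⁻¹ x*x⁻¹≡1)))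
        ∣X∣≤1+k)

module SumsOfRootsOfUnity (p : ℕ) (p-prime : Prime p) (m : ℕ) .{{_ : NonZero m}} where
  open ≡ using (refl; sym; trans; cong; cong₂; subst; module ≡-Reasoning)
  open PrimeField p p-prime
  open FinSubsets
  open Units p p-prime using (𝔽*; ≢0⇒∈𝔽*; ∈𝔽*⇒≢0; ∣𝔽*∣≡p-1)
  open RootsOfUnity p p-prime m
  open Cosets p p-prime m
  open CauchyDavenport p p-prime

  sums : ℕ → Subset p
  sums zero    = ⁅ 0# ⁆
  sums (suc j) = sums j ⊕ μ

  sums-represent : ∀ j {y} → y ∈ sums j → ∃ λ (α : Fin j → 𝔽) → (∀ i → α i ∈ μ) × sumFin j α ≡ y
  sums-represent zero    {y} y∈sums = (λ ()) , (λ ()) , sym (∈-⟦⟧⁻ (Finₚ._≟ 0#) y∈sums)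
  sums-represent (suc j) {y} y∈sums with ∈-⊕⁻ {sums j} {μ} y∈sums
  ... | z , z∈sums , y-z∈μ with sums-represent j z∈sums
  ... | α , α∈μ , Σα≡z = β , β∈μ , trans (cong ((y - z) +_) Σα≡z) (//-rightDividesˡ z y)
    where
    β : Fin (suc j) → 𝔽
    β Fin.zero    = y - z
    β (Fin.suc i) = α i
    β∈μ : ∀ i → β i ∈ μ
    β∈μ Fin.zero    = y-z∈μ
    β∈μ (Fin.suc i) = α∈μ i

  sums-nonempty : ∀ j → ∃ (_∈ sums j)
  sums-nonempty zero    = 0# , ∈-⟦⟧⁺ (Finₚ._≟ 0#) refl
  sums-nonempty (suc j) = _ , ∈-⊕⁺ (proj₂ (sums-nonempty j)) 1∈μ

  sums-μ-invariant : ∀ j → μ-invariant (sums j)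
  sums-μ-invariant zero    {h} {y} _ y∈sums =
    ∈-⟦⟧⁺ (Finₚ._≟ 0#) (trans (cong (h *_) (∈-⟦⟧⁻ (Finₚ._≟ 0#) y∈sums)) (zeroʳ h))
  sums-μ-invariant (suc j) {h} {y} h∈μ y∈sums with ∈-⊕⁻ {sums j} {μ} y∈sums
  ... | z , z∈sums , y-z∈μ = subst (_∈ sums (suc j)) hz+h[y-z]≡hy
      (∈-⊕⁺ (sums-μ-invariant j h∈μ z∈sums) (μ-*-closed h∈μ y-z∈μ))
    where
    hz+h[y-z]≡hy : h * z + h * (y - z) ≡ h * y
    hz+h[y-z]≡hy = trans (sym (distribˡ h z (y - z))) (cong (h *_) (x+[y-x]≡y z y))

  sums* : ℕ → Subset p
  sums* j = sums j ∩ 𝔽*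

  ∣μ∣∣∣sums*∣ : ∀ j → ∣ μ ∣ ∣ ∣ sums* j ∣
  ∣μ∣∣∣sums*∣ j = ∣μ∣∣∣X∣ (sums* j) (proj₂ ∘ ∈-∩⁻) sums*-invariant
    where
    sums*-invariant : μ-invariant (sums* j)
    sums*-invariant h∈μ y∈sums* with ∈-∩⁻ y∈sums*
    ... | y∈sums , y∈𝔽* = ∈-∩⁺ (sums-μ-invariant j h∈μ y∈sums)
                                 (≢0⇒∈𝔽* (*-≢0 (∈μ⇒≢0 h∈μ) (∈𝔽*⇒≢0 y∈𝔽*)))

  ∣sums∣≤1+∣sums*∣ : ∀ j → ∣ sums j ∣ ≤ suc ∣ sums* j ∣
  ∣sums∣≤1+∣sums*∣ j = begin
    ∣ sums j ∣                             ≡⟨ ∣A∣≡∣A∩B∣+∣A─B∣ (sums j) 𝔽* ⟩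
    ∣ sums* j ∣ ℕ.+ ∣ sums j ─ 𝔽* ∣         ≤⟨ ℕₚ.+-monoʳ-≤ ∣ sums* j ∣ ∣sums─𝔽*∣≤1 ⟩
    ∣ sums* j ∣ ℕ.+ 1                       ≡⟨ ℕₚ.+-comm ∣ sums* j ∣ 1 ⟩
    suc ∣ sums* j ∣                         ∎
    where
    open ℕₚ.≤-Reasoning
    ∣sums─𝔽*∣≤1 : ∣ sums j ─ 𝔽* ∣ ≤ 1
    ∣sums─𝔽*∣≤1 = ℕₚ.≤-trans
      (A⊆B⇒∣A∣≤∣B∣ {A = sums j ─ 𝔽*} {⁅ 0# ⁆} (λ y∈ → ∈-⟦⟧⁺ (Finₚ._≟ 0#) (∉𝔽*⇒≡0 (proj₂ (∈-─⁻ y∈)))))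
      (ℕₚ.≤-reflexive (∣⁅x⁆∣≡1 0#))
      where open Units p p-prime using (∉𝔽*⇒≡0)

  module _ (3≤∣μ∣ : 3 ≤ ∣ μ ∣) where

    -- Cauchy–Davenport makes sums* grow by at least ∣μ∣ - 2 > 0, and then by ∣μ∣ since both are multiples of ∣μ∣.
    sums*-grow : ∀ j → p ∸ 1 ≤ ∣ sums* (suc j) ∣ ⊎ ∣ sums* j ∣ ℕ.+ ∣ μ ∣ ≤ ∣ sums* (suc j) ∣
    sums*-grow j with cauchy-davenport (proj₂ (sums-nonempty j)) 1∈μ
    ... | inj₁ p≤∣sums∣ = inj₁ (ℕₚ.∸-monoˡ-≤ 1 (ℕₚ.≤-trans p≤∣sums∣ (∣sums∣≤1+∣sums*∣ (suc j))))
    ... | inj₂ ∣sums∣+∣μ∣≤ = inj₂ (∣-next-multiple (∣μ∣∣∣sums*∣ j) (∣μ∣∣∣sums*∣ (suc j)) ∣sums*∣<)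
      where
      open ℕₚ.≤-Reasoning
      ∣sums*∣< : ∣ sums* j ∣ < ∣ sums* (suc j) ∣
      ∣sums*∣< = ℕₚ.+-cancelˡ-≤ 2 (suc ∣ sums* j ∣) ∣ sums* (suc j) ∣ (begin
        3 ℕ.+ ∣ sums* j ∣                 ≤⟨ ℕₚ.+-monoˡ-≤ ∣ sums* j ∣ 3≤∣μ∣ ⟩
        ∣ μ ∣ ℕ.+ ∣ sums* j ∣             ≡⟨ ℕₚ.+-comm ∣ μ ∣ ∣ sums* j ∣ ⟩
        ∣ sums* j ∣ ℕ.+ ∣ μ ∣             ≤⟨ ℕₚ.+-monoˡ-≤ ∣ μ ∣ (A⊆B⇒∣A∣≤∣B∣ {A = sums* j} {sums j} (proj₁ ∘ ∈-∩⁻)) ⟩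
        ∣ sums j ∣ ℕ.+ ∣ μ ∣              ≤⟨ ∣sums∣+∣μ∣≤ ⟩
        suc ∣ sums (suc j) ∣              ≤⟨ s≤s (∣sums∣≤1+∣sums*∣ (suc j)) ⟩
        2 ℕ.+ ∣ sums* (suc j) ∣           ∎)

    growth : ∀ j → j ℕ.* ∣ μ ∣ ≤ ∣ sums* j ∣ ⊎ p ∸ 1 ≤ ∣ sums* j ∣
    growth zero    = inj₁ z≤n
    growth (suc j) with sums*-grow j | growth j
    ... | inj₁ p-1≤ | _            = inj₂ p-1≤
    ... | inj₂ grow | inj₁ j∣μ∣≤   = inj₁ (ℕₚ.≤-trans (ℕₚ.≤-reflexive (ℕₚ.+-comm ∣ μ ∣ (j ℕ.* ∣ μ ∣)))
                                              (ℕₚ.≤-trans (ℕₚ.+-monoˡ-≤ ∣ μ ∣ j∣μ∣≤) grow))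
    ... | inj₂ grow | inj₂ p-1≤    = inj₂ (ℕₚ.≤-trans p-1≤ (ℕₚ.≤-trans (ℕₚ.m≤m+n _ ∣ μ ∣) grow))

    -1∈sums : ∀ j → p ∸ 1 ≤ j ℕ.* ∣ μ ∣ → - 1# ∈ sums j
    -1∈sums j p-1≤j∣μ∣ with - 1# ∈? sums* j
    ... | yes -1∈sums* = proj₁ (∈-∩⁻ -1∈sums*)
    ... | no  -1∉sums* = ⊥-elim (ℕₚ.<⇒≱ ∣sums*∣<p-1 p-1≤∣sums*∣)
      where
      p-1≤∣sums*∣ : p ∸ 1 ≤ ∣ sums* j ∣
      p-1≤∣sums*∣ with growth j
      ... | inj₁ j∣μ∣≤ = ℕₚ.≤-trans p-1≤j∣μ∣ j∣μ∣≤
      ... | inj₂ p-1≤  = p-1≤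
      -1∈𝔽* : - 1# ∈ 𝔽*
      -1∈𝔽* = ≢0⇒∈𝔽* (λ -1≡0 → 1#≢0# (trans (sym (-‿involutive 1#)) (trans (cong -_ -1≡0) -0#≈0#)))
      ∣sums*∣<p-1 : ∣ sums* j ∣ < p ∸ 1
      ∣sums*∣<p-1 = ℕₚ.<-≤-trans (A⊂B⇒∣A∣<∣B∣ {A = sums* j} {𝔽*} (proj₂ ∘ ∈-∩⁻) -1∈𝔽* -1∉sums*)
                                 (ℕₚ.≤-reflexive ∣𝔽*∣≡p-1)

    vanishing-sum : ∀ j → p ∸ 1 ≤ j ℕ.* ∣ μ ∣ →
                    ∃ λ (α : Fin (suc j) → 𝔽) → (∀ i → pow (α i) m ≡ 1#) × sumFin (suc j) α ≡ 0#
    vanishing-sum j p-1≤j∣μ∣ with sums-represent j (-1∈sums j p-1≤j∣μ∣)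
    ... | α , α∈μ , Σα≡-1 = β , (∈μ⁻ ∘ β∈μ) , trans (cong (1# +_) Σα≡-1) (-‿inverseʳ 1#)
      where
      β : Fin (suc j) → 𝔽
      β Fin.zero    = 1#
      β (Fin.suc i) = α i
      β∈μ : ∀ i → β i ∈ μ
      β∈μ Fin.zero    = 1∈μ
      β∈μ (Fin.suc i) = α∈μ i

module PrimeSubfield {c ℓ} (p : ℕ) (p-prime : Prime p) (Ω : AlgClosedField p c ℓ) where
  module 𝔽 = PrimeField p p-prime
  open 𝔽 using (𝔽; 𝔽ₚ; p≢0)
  open AlgClosedField Ω
  open RingOpsProperties cring using (natCast-homo-+; natCast-homo-*)
  open SemiringMorphisms using (IsSemiringHomomorphism)
  open import Relation.Binary.Reasoning.Setoid setoid

  natCast-%p : ∀ x → natCast (x ℕ.% p) ≈ natCast x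
  natCast-%p x = sym (begin
    natCast x                                      ≡⟨ ≡.cong natCast (m≡m%n+[m/n]*n x p) ⟩
    natCast (x ℕ.% p ℕ.+ x ℕ./ p ℕ.* p)            ≈⟨ natCast-homo-+ (x ℕ.% p) _ ⟩
    natCast (x ℕ.% p) + natCast (x ℕ./ p ℕ.* p)    ≈⟨ +-congˡ (natCast-homo-* (x ℕ./ p) p) ⟩
    natCast (x ℕ.% p) + natCast (x ℕ./ p) * natCast p ≈⟨ +-congˡ (trans (*-congˡ charP) (zeroʳ _)) ⟩
    natCast (x ℕ.% p) + 0#                         ≈⟨ +-identityʳ _ ⟩
    natCast (x ℕ.% p)                              ∎)

  φ : 𝔽 → Carrier
  φ a = natCast (toℕ a)

  φ-homo-+ : ∀ a b → φ (a 𝔽.+ b) ≈ φ a + φ b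
  φ-homo-+ a b = begin
    natCast (toℕ (a 𝔽.+ b))               ≡⟨ ≡.cong natCast (𝔽.toℕ-[] (toℕ a ℕ.+ toℕ b)) ⟩
    natCast ((toℕ a ℕ.+ toℕ b) ℕ.% p)     ≈⟨ natCast-%p (toℕ a ℕ.+ toℕ b) ⟩
    natCast (toℕ a ℕ.+ toℕ b)             ≈⟨ natCast-homo-+ (toℕ a) (toℕ b) ⟩
    φ a + φ b                             ∎

  φ-homo-* : ∀ a b → φ (a 𝔽.* b) ≈ φ a * φ b
  φ-homo-* a b = begin
    natCast (toℕ (a 𝔽.* b))               ≡⟨ ≡.cong natCast (𝔽.toℕ-[] (toℕ a ℕ.* toℕ b)) ⟩
    natCast ((toℕ a ℕ.* toℕ b) ℕ.% p)     ≈⟨ natCast-%p (toℕ a ℕ.* toℕ b) ⟩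
    natCast (toℕ a ℕ.* toℕ b)             ≈⟨ natCast-homo-* (toℕ a) (toℕ b) ⟩
    φ a * φ b                             ∎

  φ-0 : φ 𝔽.0# ≈ 0#
  φ-0 = reflexive (≡.cong natCast 𝔽.toℕ-0#)

  φ-1 : φ 𝔽.1# ≈ 1#
  φ-1 = trans (reflexive (≡.cong natCast 𝔽.toℕ-1#)) (+-identityʳ 1#)

  φ-isSemiringHomomorphism : IsSemiringHomomorphism (Semiring.rawSemiring (CommutativeRing.semiring 𝔽ₚ))
                                                    (Semiring.rawSemiring semiring) φ
  φ-isSemiringHomomorphism = record
    { isNearSemiringHomomorphism = record
      { +-isMonoidHomomorphism = record
        { isMagmaHomomorphism = record
          { isRelHomomorphism = record { cong = λ { ≡.refl → refl } }
          ; homo = φ-homo-+ }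
        ; ε-homo = φ-0 }
      ; *-homo = φ-homo-* }
    ; 1#-homo = φ-1 }

  open HomomorphismProperties 𝔽ₚ cring φ φ-isSemiringHomomorphism using (homo-pow; homo-sumFin)

  W-from-𝔽ₚ : ∀ m {n} (α : Fin n → 𝔽) → (∀ i → 𝔽.pow (α i) m ≡ 𝔽.1#) → 𝔽.sumFin n α ≡ 𝔽.0# → W Ω m n
  W-from-𝔽ₚ m {n} α α-unity Σα≡0 = φ ∘ α , φα-unity , Σφα≡0
    where
    φα-unity : ∀ i → pow (φ (α i)) m ≈ 1#
    φα-unity i = begin
      pow (φ (α i)) m      ≈⟨ homo-pow (α i) m ⟨
      φ (𝔽.pow (α i) m)    ≡⟨ ≡.cong φ (α-unity i) ⟩
      φ 𝔽.1#               ≈⟨ φ-1 ⟩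
      1#                   ∎
    Σφα≡0 : sumFin n (φ ∘ α) ≈ 0#
    Σφα≡0 = begin
      sumFin n (φ ∘ α)     ≈⟨ homo-sumFin n α ⟨
      φ (𝔽.sumFin n α)     ≡⟨ ≡.cong φ Σα≡0 ⟩
      φ 𝔽.0#               ≈⟨ φ-0 ⟩
      0#                   ∎

W-mono : ∀ {p c ℓ} (Ω : AlgClosedField p c ℓ) {m₀ m} → m₀ ∣ m → ∀ n → W Ω m₀ n → W Ω m n
W-mono Ω {m₀} (divides t ≡.refl) n (α , α-unity , Σα≡0) = α , α-unity′ , Σα≡0
  where
  open AlgClosedField Ω
  open RingOpsProperties cring using (pow-assoc; pow-cong; pow-1#)
  open import Relation.Binary.Reasoning.Setoid setoid
  α-unity′ : ∀ i → pow (α i) (t ℕ.* m₀) ≈ 1#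
  α-unity′ i = begin
    pow (α i) (t ℕ.* m₀)     ≡⟨ ≡.cong (pow (α i)) (ℕₚ.*-comm t m₀) ⟩
    pow (α i) (m₀ ℕ.* t)     ≈⟨ pow-assoc (α i) m₀ t ⟨
    pow (pow (α i) m₀) t     ≈⟨ pow-cong t (α-unity i) ⟩
    pow 1# t                 ≈⟨ pow-1# t ⟩
    1#                       ∎

open import Data.Nat using (_+_; _^_; _/_)

corollary3p3 : ∀ {c ℓ} (p : ℕ) → Prime p → (Ω : AlgClosedField p c ℓ)
    → (m k : ℕ) → .{{_ : NonZero m}} → 1 ≤ k → m ∣ (p ^ k ∸ 1)
    → 3 ≤ gcd (p ∸ 1) m
    → (∀ n → ((p ^ k ∸ 1) / m) + 1 ≤ n → W Ω (gcd (p ∸ 1) m) n)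
      × (∀ n → W Ω (gcd (p ∸ 1) m) n → W Ω m n)
corollary3p3 p p-prime Ω m k 1≤k m∣p^k-1 3≤g = long-sums , W-mono Ω (gcd[m,n]∣n (p ∸ 1) m)
  where
  g = gcd (p ∸ 1) m
  instance
    g≢0 : NonZero g
    g≢0 = ℕ.>-nonZero (ℕₚ.<-trans (s≤s z≤n) 3≤g)
  open PrimeField p p-prime using (1<p)
  open RootsOfUnity p p-prime g using (μ; m≤∣μ∣)
  open SumsOfRootsOfUnity p p-prime g using (vanishing-sum)
  open FinSubsets using (∣_∣)
  g≤∣μ∣ : g ≤ ∣ μ ∣
  g≤∣μ∣ = m≤∣μ∣ (gcd[m,n]∣m (p ∸ 1) m)
  long-sums : ∀ n → (p ^ k ∸ 1) / m + 1 ≤ n → W Ω g n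
  long-sums zero    d+1≤0 with () ← ℕₚ.≤-trans (ℕₚ.m≤n+m 1 _) d+1≤0
  long-sums (suc j) d+1≤1+j with vanishing-sum (ℕₚ.≤-trans 3≤g g≤∣μ∣) j (begin
    p ∸ 1                       ≤⟨ p∸1≤[p^k∸1]/m*gcd[p∸1,m] m 1<p 1≤k m∣p^k-1 ⟩
    (p ^ k ∸ 1) / m ℕ.* g       ≤⟨ ℕₚ.*-monoˡ-≤ g (ℕₚ.≤-pred (ℕₚ.≤-trans (ℕₚ.≤-reflexive (ℕₚ.+-comm 1 _)) d+1≤1+j)) ⟩
    j ℕ.* g                     ≤⟨ ℕₚ.*-monoʳ-≤ j g≤∣μ∣ ⟩
    j ℕ.* ∣ μ ∣                 ∎)
    where open ℕₚ.≤-Reasoning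
  ... | α , α-unity , Σα≡0 = PrimeSubfield.W-from-𝔽ₚ p p-prime Ω g α α-unity Σα≡0
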